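{- Let $n$ be divisible by $4$, let $M\subset[n]$ with $|M|=n/2$, $A\subset\overline M$ with $|A|=n/4$, and let $G$ be any graph (with at least one edge) on vertex set $\overline M=[n]\setminus M$. If $\boldsymbol f=f_{M,A,\mathbf H}$ where $\mathbf H\sim\mathcal E(G)$, then with probability at least $1-o(1)$ (as $n\to\infty$), $$\tfrac14\chi(G)-o(1)\le \mathrm{dist}(\boldsymbol f,\text{$k$-Junta})\le\tfrac14\chi(G)+o(1),$$ where $k=3n/4$.
   Context: Let $m=n/2$, $N=2^m$. Fix an ordering of $M$ and let $\Gamma_M\colon\{0,1\}^n\to[N]$ map $x$ to $1$ plus the integer whose binary expansion is $x|_M$ (so $\Gamma_M(x)\le N/2$ iff the highest-order coordinate of $M$ is $0$ in $x$). The distribution $\mathcal E(G)$ over sequences $\mathbf H=(\boldsymbol h_i\colon\{0,1\}^n\to\{0,1\})_{i\in[N]}$: for $i\le N/2$, $\boldsymbol h_i(x)=\bigoplus_{\ell\in M}x_\ell$; for each $i>N/2$, independently, sample a uniformly random edge $(\boldsymbol j_1,\boldsymbol j_2)$ of $G$ and a uniform bit $\boldsymbol r$, and set $\boldsymbol h_i(x)=x_{\boldsymbol j_1}\oplus x_{\boldsymbol j_2}\oplus\boldsymbol r$. Define $f_{M,A,\mathbf H}(x)=\boldsymbol h_{\Gamma_M(x)}(x)$. For $S_1,S_2\subseteq\overline M$ let $E_G(S_1,S_2)$ be the number of edges of $G$ with one endpoint in $S_1$ and the other in $S_2$, and let $\chi(G)=\min\{(E_G(S,S)+E_G(S,\overline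 S))/E_G(\overline M,\overline M): S\subseteq\overline M,\ |S|\ge n/4\}$, where $\overline S=\overline M\setminus S$ (i.e. the minimum fraction of edges with at least one endpoint in $S$). A $k$-junta is a function depending on at most $k$ variables; $\mathrm{dist}(f,g)=\Pr_{\boldsymbol x}[f(\boldsymbol x)\ne g(\boldsymbol x)]$ for uniform $\boldsymbol x$, and $\mathrm{dist}(f,\text{$k$-Junta})$ is the minimum over $k$-juntas $g$. -}

module Defs where

open import Data.Bool using (Bool; true; false; if_then_else_; _∧_; _∨_; _xor_; not)
open import Data.Nat as ℕ using (ℕ; zero; suc; _^_; _∸_; _<ᵇ_; _<?_; _/_)
open import Data.Fin using (Fin; toℕ; fromℕ<)
open import Data.Fin.Subset using (Subset; ∣_∣; ∁; _∩_)
open import Data.Vec using (Vec; []; _∷_; lookup)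
open import Data.List as List using (List; []; _∷_; [_]; length; concatMap; map; allFin; foldr)
open import Data.Product using (_×_; _,_; Σ; ∃; proj₁; proj₂)
open import Data.Integer using (+_)
open import Data.Rational as ℚ using (ℚ; 0ℚ)
open import Relation.Nullary using (yes; no; ¬_)
open import Relation.Binary.PropositionalEquality using (_≡_)

allVecs : {A : Set} → List A → (n : ℕ) → List (Vec A n)
allVecs xs zero    = [ [] ]
allVecs xs (suc n) = concatMap (λ a → map (a ∷_) (allVecs xs n)) xs

countᵇ : {A : Set} → (A → Bool) → List A → ℕ
countᵇ p = foldr (λ a k → if p a then suc k else k) 0

-- the rational a/d (d is always positive where used; 0 if d = 0)
frac : ℕ → ℕ → ℚ
frac a zero    = 0ℚ
frac a (suc d) = (+ a) ℚ./ suc d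

ℕ→ℚ : ℕ → ℚ
ℕ→ℚ a = (+ a) ℚ./ 1

Input : ℕ → Set
Input n = Vec Bool n

allInputs : (n : ℕ) → List (Input n)
allInputs = allVecs (false ∷ true ∷ [])

dist : {n : ℕ} → (Input n → Bool) → (Input n → Bool) → ℚ
dist {n} f g = frac (countᵇ (λ x → f x xor g x) (allInputs n)) (2 ^ n)

IsJunta : {n : ℕ} → ℕ → (Input n → Bool) → Set
IsJunta {n} k g =
  Σ (Subset n) λ J → (∣ J ∣ ℕ.≤ k) ×
    (∀ (x y : Input n) → (∀ i → lookup J i ≡ true → lookup x i ≡ lookup y i) → g x ≡ g y)

IsDistToJunta : {n : ℕ} → ℕ → (Input n → Bool) → ℚ → Set
IsDistToJunta {n} k f d =
  (Σ (Input n → Bool) λ g → IsJunta k g × dist f g ≡ d) ×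
  (∀ (g : Input n → Bool) → IsJunta k g → d ℚ.≤ dist f g)

Graph : ℕ → Set
Graph n = Fin n → Fin n → Bool

IsGraphOn : {n : ℕ} → Subset n → Graph n → Set
IsGraphOn V G =
  (∀ i j → G i j ≡ G j i) × (∀ i → G i i ≡ false) ×
  (∀ i j → G i j ≡ true → (lookup V i ≡ true) × (lookup V j ≡ true))

edges : {n : ℕ} → Graph n → List (Fin n × Fin n)
edges {n} G =
  concatMap (λ i → concatMap (λ j → if G i j ∧ (toℕ i <ᵇ toℕ j) then [ (i , j) ] else [])
                               (allFin n))
            (allFin n)

numEdges : {n : ℕ} → Graph n → ℕ
numEdges G = length (edges G)

E : {n : ℕ} → Graph n → Subset n → Subset n → ℕ
E G S₁ S₂ = countᵇ (λ e → (lookup S₁ (proj₁ e) ∧ lookup S₂ (proj₂ e))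
                         ∨ (lookup S₂ (proj₁ e) ∧ lookup S₁ (proj₂ e))) (edges G)

chiFrac : {n : ℕ} → Subset n → Graph n → Subset n → ℚ
chiFrac M G S = frac (E G S S ℕ.+ E G S (∁ M ∩ ∁ S)) (E G (∁ M) (∁ M))

ChiAdmissible : {n : ℕ} → Subset n → Subset n → Set
ChiAdmissible {n} M S = (∀ i → lookup S i ≡ true → lookup M i ≡ false) × (n / 4 ℕ.≤ ∣ S ∣)

IsChi : {n : ℕ} → Subset n → Graph n → ℚ → Set
IsChi {n} M G c =
  (Σ (Subset n) λ S → ChiAdmissible M S × chiFrac M G S ≡ c) ×
  (∀ (S : Subset n) → ChiAdmissible M S → c ℚ.≤ chiFrac M G S)

half : ℕ → ℕ
half n = (2 ^ (n / 2)) / 2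

-- 0-based Γ_M(x) - 1 = Σ_k x_{σ(k)} 2^k, where σ : Fin m → Fin n is the ordering of M
-- (σ(m-1) is the highest-order coordinate)
Γ₀ : {n : ℕ} → (Fin (n / 2) → Fin n) → Input n → ℕ
Γ₀ {n} σ x = foldr (λ k s → (if lookup x (σ k) then 2 ^ toℕ k else 0) ℕ.+ s) 0 (allFin (n / 2))

parityOn : {n : ℕ} → Subset n → Input n → Bool
parityOn {n} M x = foldr (λ ℓ b → (lookup M ℓ ∧ lookup x ℓ) xor b) false (allFin n)

-- A sample of H ~ E(G): for each index i > N/2 (i.e. 0-based index N/2 + j, j < N/2)
-- an edge (index into the edge list, uniform) and a bit r.
Sample : (n : ℕ) → Graph n → Set
Sample n G = Vec (Fin (numEdges G) × Bool) (half n)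

-- the function h_{N/2+1+j}(x) = x_{j1} ⊕ x_{j2} ⊕ r
hHigh : {n : ℕ} (G : Graph n) → Sample n G → ℕ → Input n → Bool
hHigh {n} G H j x with j <? half n
... | yes p = let er = lookup H (fromℕ< p)
                  e  = List.lookup (edges G) (proj₁ er)
              in lookup x (proj₁ e) xor lookup x (proj₂ e) xor proj₂ er
... | no _  = false   -- unreachable since Γ₀ x < N

-- f_{M,A,H}(x) = h_{Γ_M(x)}(x)   (A does not enter the definition of f)
fMAH : {n : ℕ} → (M : Subset n) → (σ : Fin (n / 2) → Fin n) → (A : Subset n) →
       (G : Graph n) → Sample n G → Input n → Bool
fMAH {n} M σ A G H x =
  if Γ₀ σ x <ᵇ half n then parityOn M x else hHigh G H (Γ₀ σ x ∸ half n) x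

module Submission where

-- Let K = N/2. On inputs x with Γ(x) < K, f is the parity of M; on the others it is x_a ⊕ x_b ⊕ r for the
-- edge (a, b) drawn for block Γ(x) - K. A junta that ignores a coordinate of M errs on a quarter of the inputs:
-- flipping that coordinate negates the parity on the low half (for the top coordinate, which selects the half,
-- pair the low half through an endpoint of the edge of the partner high block instead). A junta ignoring a set
-- T ⊆ M̄ of size at least n/4 errs on at least half of the inputs whose block edge touches T, since flipping the
-- endpoint in T negates f, and f with these inputs set to 0 attains this. So dist(f, k-Junta) is the least
-- number of high blocks touching such a T, divided by 4K. By Chebyshev over all (2|E|)^K samples, for all but
-- a 1/q fraction every edge is drawn K/|E| ± K/(q|E|) times, so that number is K χ(G) ± K/q.

open import Defs
import Data.Bool as Bool
open import Data.Bool using (Bool; true; false; if_then_else_; _∧_; _∨_; _xor_; not)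
open import Data.Bool.Properties
  using (not-involutive; not-injective; not-distribˡ-xor; not-distribʳ-xor; xor-same; xor-comm; xor-identityʳ;
         ∨-conicalˡ; ∨-conicalʳ; T-≡; ∧-comm; ⇔→≡)
open import Data.Empty using (⊥; ⊥-elim)
open import Data.Fin.Subset using (Subset; ∁; _∩_; ∣_∣; _⊆_) renaming (_∈_ to _∈ₛ_)
open import Data.Fin.Subset.Properties using (∣∁p∣≡n∸∣p∣)
open import Data.Fin using (Fin; zero; suc; toℕ; fromℕ; fromℕ<; _≟_)
open import Data.Fin.Properties using (suc-injective; all?; any?; ¬∀⟶∃¬; fromℕ<-toℕ; toℕ<n)
open import Data.List as List using (List; []; _∷_; [_]; _++_; map; concatMap; foldr; length; tabulate; allFin)
open import Data.List.Properties using (length-++; length-tabulate)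
open import Data.List.Membership.Propositional using (_∈_)
open import Data.List.Membership.Propositional.Properties using (∈-lookup; ∈-concatMap⁺; ∈-concatMap⁻; ∈-map⁺; ∈-map⁻)
open import Data.List.Relation.Unary.Any as Any using (Any; here; there)
open import Data.List.Relation.Unary.Unique.Propositional using (Unique)
import Data.List.Relation.Unary.Unique.Propositional.Properties as UniqueP
open import Data.List.Relation.Unary.All as All using (All; []; _∷_)
import Data.List.Relation.Unary.All.Properties as AllP
open import Data.List.Relation.Unary.AllPairs using ([]; _∷_)
open import Data.Nat as ℕ
  using (ℕ; zero; suc; _+_; _*_; _^_; _∸_; _≤_; _<_; z≤n; s≤s; _<ᵇ_; _<?_; _≤?_; _/_; ∣_-_∣)
open import Data.Nat.Properties hiding (_≟_; suc-injective)
open import Data.Nat.Divisibility using (_∣_; divides)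
open import Data.Nat.DivMod using (m/n≤m; m*n/n≡m)
open import Data.Nat.Tactic.RingSolver using (solve-∀)
import Data.Integer as ℤ
import Data.Integer.Properties as ℤP
open import Data.Rational as ℚ using (ℚ; 0ℚ; 1ℚ; toℚᵘ)
import Data.Rational.Properties as ℚP
open import Data.Rational.Unnormalised as ℚᵘ using (mkℚᵘ)
import Data.Rational.Unnormalised.Properties as ℚᵘP
open import Data.Product using (_×_; _,_; proj₁; proj₂; Σ; ∃)
open import Data.Sum using (_⊎_; inj₁; inj₂)
open import Data.Vec as Vec using (Vec; []; _∷_; lookup; _[_]%=_)
open import Data.Vec.Properties
  using ([]=⇒lookup; ∷-injectiveˡ; ∷-injectiveʳ; lookup∘updateAt; lookup∘updateAt′; []%=-∘; []%=-id; updateAt-cong;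
         updateAt-commutes; lookup∘tabulate; lookup-map; lookup-zipWith)
open import Function.Base using (id)
open import Function.Bundles using (Equivalence; mk⇔)
open import Function.Definitions using (Injective)
open import Relation.Binary.PropositionalEquality hiding ([_])
open import Relation.Nullary using (¬_; Dec; yes; no; does)
open import Relation.Nullary.Decidable using (dec-true; dec-false; _×-dec_; _→-dec_)

private
  variable
    A B : Set

true≢false : true ≢ false
true≢false ()

𝟙 : Bool → ℕ
𝟙 true  = 1
𝟙 false = 0

𝟙≤1 : ∀ b → 𝟙 b ≤ 1
𝟙≤1 true  = s≤s z≤n
𝟙≤1 false = z≤n

𝟙-split : ∀ a b → 𝟙 a ≡ 𝟙 (a ∧ b) + 𝟙 (a ∧ not b)
𝟙-split true  true  = refl
𝟙-split true  false = refl
𝟙-split false _     = refl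

𝟙-idem : ∀ b → 𝟙 b * 𝟙 b ≡ 𝟙 b
𝟙-idem true  = refl
𝟙-idem false = refl

sumL : List A → (A → ℕ) → ℕ
sumL []       F = 0
sumL (x ∷ xs) F = F x + sumL xs F

sumL-cong : (L : List A) {F G : A → ℕ} → (∀ x → F x ≡ G x) → sumL L F ≡ sumL L G
sumL-cong []      e = refl
sumL-cong (x ∷ L) e = cong₂ _+_ (e x) (sumL-cong L e)

sumL-++ : (L L′ : List A) (F : A → ℕ) → sumL (L ++ L′) F ≡ sumL L F + sumL L′ F
sumL-++ []      L′ F = refl
sumL-++ (x ∷ L) L′ F = trans (cong (F x +_) (sumL-++ L L′ F)) (sym (+-assoc (F x) _ _))

sumL-map : (f : A → B) (L : List A) (F : B → ℕ) → sumL (map f L) F ≡ sumL L (λ x → F (f x))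
sumL-map f []      F = refl
sumL-map f (x ∷ L) F = cong (F (f x) +_) (sumL-map f L F)

sumL-concatMap : (f : A → List B) (L : List A) (F : B → ℕ) →
  sumL (concatMap f L) F ≡ sumL L (λ a → sumL (f a) F)
sumL-concatMap f []      F = refl
sumL-concatMap f (x ∷ L) F = trans (sumL-++ (f x) (concatMap f L) F) (cong (sumL (f x) F +_) (sumL-concatMap f L F))

sumL-+ : (L : List A) (F G : A → ℕ) → sumL L (λ x → F x + G x) ≡ sumL L F + sumL L G
sumL-+ []      F G = refl
sumL-+ (x ∷ L) F G = trans (cong (F x + G x +_) (sumL-+ L F G)) (+-interchange (F x) (G x) _ _ )
  where
  +-interchange : ∀ a b c d → a + b + (c + d) ≡ a + c + (b + d)
  +-interchange = solve-∀

sumL-*ˡ : (L : List A) (c : ℕ) (F : A → ℕ) → sumL L (λ x → c * F x) ≡ c * sumL L F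
sumL-*ˡ []      c F = sym (*-zeroʳ c)
sumL-*ˡ (x ∷ L) c F = trans (cong (c * F x +_) (sumL-*ˡ L c F)) (sym (*-distribˡ-+ c (F x) _))

sumL-const : (L : List A) (c : ℕ) → sumL L (λ _ → c) ≡ c * length L
sumL-const []      c = sym (*-zeroʳ c)
sumL-const (x ∷ L) c = trans (cong (c +_) (sumL-const L c)) (sym (*-suc c (length L)))

sumL-mono : (L : List A) {F G : A → ℕ} → (∀ x → F x ≤ G x) → sumL L F ≤ sumL L G
sumL-mono []      e = z≤n
sumL-mono (x ∷ L) e = +-mono-≤ (e x) (sumL-mono L e)

sumL-swap : (L : List A) (L′ : List B) (F : A → B → ℕ) →
  sumL L (λ a → sumL L′ (F a)) ≡ sumL L′ (λ b → sumL L (λ a → F a b))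
sumL-swap []      L′ F = sym (sumL-const L′ 0)
sumL-swap (x ∷ L) L′ F =
  trans (cong (sumL L′ (F x) +_) (sumL-swap L L′ F)) (sym (sumL-+ L′ (F x) (λ b → sumL L (λ a → F a b))))

countᵇ≡sumL : (p : A → Bool) (L : List A) → countᵇ p L ≡ sumL L (λ x → 𝟙 (p x))
countᵇ≡sumL p []      = refl
countᵇ≡sumL p (x ∷ L) with p x
... | true  = cong suc (countᵇ≡sumL p L)
... | false = countᵇ≡sumL p L

sumFin : (m : ℕ) → (Fin m → ℕ) → ℕ
sumFin zero    g = 0
sumFin (suc m) g = g zero + sumFin m (λ k → g (suc k))

sumFin-cong : (m : ℕ) {g h : Fin m → ℕ} → (∀ k → g k ≡ h k) → sumFin m g ≡ sumFin m h
sumFin-cong zero    e = refl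
sumFin-cong (suc m) e = cong₂ _+_ (e zero) (sumFin-cong m (λ k → e (suc k)))

sumFin-const : (m c : ℕ) → sumFin m (λ _ → c) ≡ m * c
sumFin-const zero    c = refl
sumFin-const (suc m) c = cong (c +_) (sumFin-const m c)

sumFin-*ˡ : (m c : ℕ) (g : Fin m → ℕ) → sumFin m (λ k → c * g k) ≡ c * sumFin m g
sumFin-*ˡ zero    c g = sym (*-zeroʳ c)
sumFin-*ˡ (suc m) c g =
  trans (cong (c * g zero +_) (sumFin-*ˡ m c (λ k → g (suc k)))) (sym (*-distribˡ-+ c (g zero) _))

sumFin-+ : (m : ℕ) (g h : Fin m → ℕ) → sumFin m (λ k → g k + h k) ≡ sumFin m g + sumFin m h
sumFin-+ zero    g h = refl
sumFin-+ (suc m) g h = trans (cong (g zero + h zero +_) (sumFin-+ m (λ k → g (suc k)) (λ k → h (suc k))))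
  (+-interchange (g zero) (h zero) _ _)
  where
  +-interchange : ∀ a b c d → a + b + (c + d) ≡ a + c + (b + d)
  +-interchange = solve-∀

sumFin-*ʳ : (m : ℕ) (g : Fin m → ℕ) (c : ℕ) → sumFin m g * c ≡ sumFin m (λ k → g k * c)
sumFin-*ʳ zero    g c = refl
sumFin-*ʳ (suc m) g c = trans (*-distribʳ-+ c (g zero) _) (cong (g zero * c +_) (sumFin-*ʳ m (λ k → g (suc k)) c))

sumFin-≥ : (m : ℕ) (g : Fin m → ℕ) (i : Fin m) → g i ≤ sumFin m g
sumFin-≥ (suc m) g zero    = m≤m+n _ _
sumFin-≥ (suc m) g (suc i) = ≤-trans (sumFin-≥ m (λ k → g (suc k)) i) (m≤n+m _ _)

sumFin-mono : (m : ℕ) {g h : Fin m → ℕ} → (∀ k → g k ≤ h k) → sumFin m g ≤ sumFin m h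
sumFin-mono zero    e = z≤n
sumFin-mono (suc m) e = +-mono-≤ (e zero) (sumFin-mono m (λ k → e (suc k)))

sumFin-swap : (m k : ℕ) (F : Fin m → Fin k → ℕ) →
  sumFin m (λ i → sumFin k (F i)) ≡ sumFin k (λ j → sumFin m (λ i → F i j))
sumFin-swap zero    k F = sym (trans (sumFin-const k 0) (*-zeroʳ k))
sumFin-swap (suc m) k F = trans (cong (sumFin k (F zero) +_) (sumFin-swap m k (λ i → F (suc i))))
  (sym (sumFin-+ k (F zero) (λ j → sumFin m (λ i → F (suc i) j))))

sumL-tabulate : (m : ℕ) (f : Fin m → A) (w : A → ℕ) → sumL (tabulate f) w ≡ sumFin m (λ k → w (f k))
sumL-tabulate zero    f w = refl
sumL-tabulate (suc m) f w = cong (w (f zero) +_) (sumL-tabulate m (λ k → f (suc k)) w)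

sumL-lookup : (L : List A) (F : A → ℕ) → sumL L F ≡ sumFin (length L) (λ i → F (List.lookup L i))
sumL-lookup []      F = refl
sumL-lookup (x ∷ L) F = cong (F x +_) (sumL-lookup L F)

sumL-sumFin : (L : List A) (m : ℕ) (F : A → Fin m → ℕ) →
  sumL L (λ a → sumFin m (F a)) ≡ sumFin m (λ e → sumL L (λ a → F a e))
sumL-sumFin []      m F = sym (trans (sumFin-const m 0) (*-zeroʳ m))
sumL-sumFin (x ∷ L) m F =
  trans (cong (sumFin m (F x) +_) (sumL-sumFin L m F)) (sym (sumFin-+ m (F x) (λ e → sumL L (λ a → F a e))))

eqᶠ : {m : ℕ} → Fin m → Fin m → Bool
eqᶠ zero    zero    = true
eqᶠ zero    (suc _) = false
eqᶠ (suc _) zero    = false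
eqᶠ (suc a) (suc b) = eqᶠ a b

eqᶠ-sym : {m : ℕ} (a b : Fin m) → eqᶠ a b ≡ eqᶠ b a
eqᶠ-sym zero    zero    = refl
eqᶠ-sym zero    (suc b) = refl
eqᶠ-sym (suc a) zero    = refl
eqᶠ-sym (suc a) (suc b) = eqᶠ-sym a b

sumFin-delta : (m : ℕ) (a : Fin m) (F : Fin m → ℕ) → sumFin m (λ e → 𝟙 (eqᶠ a e) * F e) ≡ F a
sumFin-delta (suc m) zero    F = trans (cong (F zero + 0 +_) (trans (sumFin-const m 0) (*-zeroʳ m))) (trans (+-identityʳ _) (+-identityʳ _))
sumFin-delta (suc m) (suc a) F = sumFin-delta m a (λ e → F (suc e))

sumN : ℕ → (ℕ → ℕ) → ℕ
sumN zero    g = 0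
sumN (suc N) g = g 0 + sumN N (λ i → g (suc i))

sumN-cong : (N : ℕ) {g h : ℕ → ℕ} → (∀ i → g i ≡ h i) → sumN N g ≡ sumN N h
sumN-cong zero    e = refl
sumN-cong (suc N) e = cong₂ _+_ (e 0) (sumN-cong N (λ i → e (suc i)))

sumN-+ : (a b : ℕ) (g : ℕ → ℕ) → sumN (a + b) g ≡ sumN a g + sumN b (λ i → g (a + i))
sumN-+ zero    b g = refl
sumN-+ (suc a) b g = trans (cong (g 0 +_) (sumN-+ a b (λ i → g (suc i)))) (sym (+-assoc (g 0) _ _))

sumN-even-odd : (N : ℕ) (g : ℕ → ℕ) → sumN (N + N) g ≡ sumN N (λ i → g (2 * i)) + sumN N (λ i → g (suc (2 * i)))
sumN-even-odd zero    g = refl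
sumN-even-odd (suc N) g = begin
  sumN (suc N + suc N) g
    ≡⟨ cong (λ z → g 0 + sumN z (λ i → g (suc i))) (+-suc N N) ⟩
  g 0 + (g 1 + sumN (N + N) (λ i → g (2 + i)))
    ≡⟨ cong (λ z → g 0 + (g 1 + z)) (sumN-even-odd N (λ i → g (2 + i))) ⟩
  g 0 + (g 1 + (sumN N (λ i → g (2 + 2 * i)) + sumN N (λ i → g (3 + 2 * i))))
    ≡⟨ shuffle (g 0) (g 1) _ _ ⟩
  (g 0 + sumN N (λ i → g (2 + 2 * i))) + (g 1 + sumN N (λ i → g (3 + 2 * i)))
    ≡⟨ cong₂ (λ u v → (g 0 + u) + (g 1 + v)) (sumN-cong N (λ i → cong g (sym (*-suc 2 i))))
                                             (sumN-cong N (λ i → cong (λ z → g (suc z)) (sym (*-suc 2 i)))) ⟩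
  sumN (suc N) (λ i → g (2 * i)) + sumN (suc N) (λ i → g (suc (2 * i))) ∎
  where
  open ≡-Reasoning
  shuffle : ∀ a b c d → a + (b + (c + d)) ≡ (a + c) + (b + d)
  shuffle = solve-∀

sumN-vanishing : (N : ℕ) (g : ℕ → ℕ) → (∀ i → i < N → g i ≡ 0) → sumN N g ≡ 0
sumN-vanishing zero    g h = refl
sumN-vanishing (suc N) g h = cong₂ _+_ (h 0 (s≤s z≤n)) (sumN-vanishing N (λ i → g (suc i)) (λ i p → h (suc i) (s≤s p)))

sumN≡sumFin : (N : ℕ) (g : ℕ → ℕ) → sumN N g ≡ sumFin N (λ k → g (toℕ k))
sumN≡sumFin zero    g = refl
sumN≡sumFin (suc N) g = cong (g 0 +_) (sumN≡sumFin N (λ i → g (suc i)))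

sumInputs-suc : (n : ℕ) (F : Input (suc n) → ℕ) →
  sumL (allInputs (suc n)) F ≡ sumL (allInputs n) (λ x → F (false ∷ x)) + sumL (allInputs n) (λ x → F (true ∷ x))
sumInputs-suc n F = begin
  sumL (allInputs (suc n)) F
    ≡⟨ sumL-concatMap (λ a → map (a ∷_) (allInputs n)) (false ∷ true ∷ []) F ⟩
  sumL (map (false ∷_) (allInputs n)) F + (sumL (map (true ∷_) (allInputs n)) F + 0)
    ≡⟨ cong₂ (λ a b → a + (b + 0)) (sumL-map (false ∷_) (allInputs n) F) (sumL-map (true ∷_) (allInputs n) F) ⟩
  sumL (allInputs n) (λ x → F (false ∷ x)) + (sumL (allInputs n) (λ x → F (true ∷ x)) + 0)
    ≡⟨ cong (sumL (allInputs n) (λ x → F (false ∷ x)) +_) (+-identityʳ _) ⟩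
  sumL (allInputs n) (λ x → F (false ∷ x)) + sumL (allInputs n) (λ x → F (true ∷ x)) ∎
  where open ≡-Reasoning

count : (n : ℕ) → (Input n → Bool) → ℕ
count n p = sumL (allInputs n) (λ x → 𝟙 (p x))

count-cong : (n : ℕ) {p q : Input n → Bool} → (∀ x → p x ≡ q x) → count n p ≡ count n q
count-cong n e = sumL-cong (allInputs n) (λ x → cong 𝟙 (e x))

count-split : (n : ℕ) (p q : Input n → Bool) →
  count n p ≡ count n (λ x → p x ∧ q x) + count n (λ x → p x ∧ not (q x))
count-split n p q = trans (sumL-cong (allInputs n) (λ x → 𝟙-split (p x) (q x)))
  (sumL-+ (allInputs n) (λ x → 𝟙 (p x ∧ q x)) (λ x → 𝟙 (p x ∧ not (q x))))

count-mono : (n : ℕ) {p q : Input n → Bool} → (∀ x → p x ≡ true → q x ≡ true) → count n p ≤ count n q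
count-mono n {p} {q} h = sumL-mono (allInputs n) 𝟙-mono
  where
  𝟙-mono : ∀ x → 𝟙 (p x) ≤ 𝟙 (q x)
  𝟙-mono x with p x in e
  ... | false = z≤n
  ... | true  rewrite h x e = ≤-refl

count-true : (n : ℕ) → count n (λ _ → true) ≡ 2 ^ n
count-true zero    = refl
count-true (suc n) = trans (sumInputs-suc n (λ _ → 1))
  (trans (cong₂ _+_ (count-true n) (count-true n)) (cong (2 ^ n +_) (sym (+-identityʳ _))))

count≤2^n : (n : ℕ) (p : Input n → Bool) → count n p ≤ 2 ^ n
count≤2^n n p = subst (count n p ≤_) (count-true n) (count-mono n (λ _ _ → refl))

eqᵇ : Bool → Bool → Bool
eqᵇ true  b = b
eqᵇ false b = not b

eqᵛ : {n : ℕ} → Vec Bool n → Vec Bool n → Bool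
eqᵛ []      []      = true
eqᵛ (a ∷ x) (b ∷ y) = eqᵇ a b ∧ eqᵛ x y

eqᵛ-sym : {n : ℕ} (x y : Vec Bool n) → eqᵛ x y ≡ eqᵛ y x
eqᵛ-sym []          []          = refl
eqᵛ-sym (true ∷ x)  (true ∷ y)  = eqᵛ-sym x y
eqᵛ-sym (true ∷ x)  (false ∷ y) = refl
eqᵛ-sym (false ∷ x) (true ∷ y)  = refl
eqᵛ-sym (false ∷ x) (false ∷ y) = eqᵛ-sym x y

eqᵛ-refl : {n : ℕ} (x : Vec Bool n) → eqᵛ x x ≡ true
eqᵛ-refl []          = refl
eqᵛ-refl (true ∷ x)  = eqᵛ-refl x
eqᵛ-refl (false ∷ x) = eqᵛ-refl x

eqᵛ⇒≡ : {n : ℕ} (x y : Vec Bool n) → eqᵛ x y ≡ true → x ≡ y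
eqᵛ⇒≡ []          []          e = refl
eqᵛ⇒≡ (true ∷ x)  (true ∷ y)  e = cong (true ∷_) (eqᵛ⇒≡ x y e)
eqᵛ⇒≡ (false ∷ x) (false ∷ y) e = cong (false ∷_) (eqᵛ⇒≡ x y e)

sumInputs-delta : (n : ℕ) (w : Input n) (F : Input n → ℕ) → sumL (allInputs n) (λ y → 𝟙 (eqᵛ w y) * F y) ≡ F w
sumInputs-delta zero    []          F = trans (+-identityʳ _) (*-identityˡ _)
sumInputs-delta (suc n) (false ∷ w) F =
  trans (sumInputs-suc n _)
        (trans (cong₂ _+_ (sumInputs-delta n w (λ y → F (false ∷ y))) (sumL-const (allInputs n) 0)) (+-identityʳ _))
sumInputs-delta (suc n) (true ∷ w)  F =
  trans (sumInputs-suc n _) (cong₂ _+_ (sumL-const (allInputs n) 0) (sumInputs-delta n w (λ y → F (true ∷ y))))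

count-eqᵛ : (n : ℕ) (z : Input n) → count n (λ x → eqᵛ x z) ≡ 1
count-eqᵛ n z = trans (sumL-cong (allInputs n) (λ x → trans (cong 𝟙 (eqᵛ-sym x z)) (sym (*-identityʳ _))))
                      (sumInputs-delta n z (λ _ → 1))

sumInputs-involution : (n : ℕ) (φ : Input n → Input n) → (∀ x → φ (φ x) ≡ x) → (F : Input n → ℕ) →
  sumL (allInputs n) (λ x → F (φ x)) ≡ sumL (allInputs n) F
sumInputs-involution n φ inv F = begin
  sumL I (λ x → F (φ x))
    ≡⟨ sumL-cong I (λ x → sym (sumInputs-delta n (φ x) F)) ⟩
  sumL I (λ x → sumL I (λ y → 𝟙 (eqᵛ (φ x) y) * F y))
    ≡⟨ sumL-swap I I _ ⟩
  sumL I (λ y → sumL I (λ x → 𝟙 (eqᵛ (φ x) y) * F y))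
    ≡⟨ sumL-cong I (λ y → sumL-cong I (λ x → trans (cong (λ b → 𝟙 b * F y) (transpose x y)) (*-comm _ (F y)))) ⟩
  sumL I (λ y → sumL I (λ x → F y * 𝟙 (eqᵛ x (φ y))))
    ≡⟨ sumL-cong I (λ y → trans (sumL-*ˡ I (F y) _) (trans (cong (F y *_) (count-eqᵛ n (φ y))) (*-identityʳ _))) ⟩
  sumL I F ∎
  where
  open ≡-Reasoning
  I = allInputs n
  transpose : ∀ x y → eqᵛ (φ x) y ≡ eqᵛ x (φ y)
  transpose x y = ⇔→≡ {z = true} (mk⇔
    (λ e → trans (cong (eqᵛ x) (trans (cong φ (sym (eqᵛ⇒≡ (φ x) y e))) (inv x))) (eqᵛ-refl x))
    (λ e → trans (cong (λ z → eqᵛ (φ z) y) (eqᵛ⇒≡ x (φ y) e)) (trans (cong (λ z → eqᵛ z y) (inv y)) (eqᵛ-refl y))))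

count-involution : (n : ℕ) (φ : Input n → Input n) → (∀ x → φ (φ x) ≡ x) → (p : Input n → Bool) →
  count n (λ x → p (φ x)) ≡ count n p
count-involution n φ inv p = sumInputs-involution n φ inv (λ x → 𝟙 (p x))

count-disagree-half : (n : ℕ) (φ : Input n → Input n) → (∀ x → φ (φ x) ≡ x) →
  (B f g : Input n → Bool) → (∀ x → B (φ x) ≡ B x) →
  (∀ x → B x ≡ true → f (φ x) ≡ not (f x)) → (∀ x → B x ≡ true → g (φ x) ≡ g x) →
  count n (λ x → B x ∧ (f x xor g x)) + count n (λ x → B x ∧ (f x xor g x)) ≡ count n B
count-disagree-half n φ inv B f g hB hf hg = begin
  count n P + count n P              ≡⟨ cong (count n P +_) (sym (count-involution n φ inv P)) ⟩
  count n P + count n (λ x → P (φ x)) ≡⟨ cong (count n P +_) (count-cong n Pφ) ⟩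
  count n P + count n (λ x → B x ∧ not (f x xor g x)) ≡⟨ sym (count-split n B (λ x → f x xor g x)) ⟩
  count n B ∎
  where
  open ≡-Reasoning
  P : Input n → Bool
  P x = B x ∧ (f x xor g x)
  Pφ : ∀ x → P (φ x) ≡ (B x ∧ not (f x xor g x))
  Pφ x with B x in e
  ... | false rewrite hB x | e = refl
  ... | true  rewrite hB x | e | hf x e | hg x e = sym (not-distribˡ-xor (f x) (g x))

flipAt : {n : ℕ} → Fin n → Input n → Input n
flipAt i x = x [ i ]%= not

flipAt-same : {n : ℕ} (i : Fin n) (x : Input n) → lookup (flipAt i x) i ≡ not (lookup x i)
flipAt-same i x = lookup∘updateAt i x

flipAt-other : {n : ℕ} (i j : Fin n) (x : Input n) → i ≢ j → lookup (flipAt i x) j ≡ lookup x j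
flipAt-other i j x i≢j = lookup∘updateAt′ j i (λ e → i≢j (sym e)) x

flipAt-involutive : {n : ℕ} (i : Fin n) (x : Input n) → flipAt i (flipAt i x) ≡ x
flipAt-involutive i x = trans ([]%=-∘ x i) (trans (updateAt-cong i not-involutive x) ([]%=-id x i))

flipAt-comm : {n : ℕ} (i j : Fin n) (x : Input n) → flipAt i (flipAt j x) ≡ flipAt j (flipAt i x)
flipAt-comm i j x with i ≟ j
... | yes refl = refl
... | no  i≢j  = updateAt-commutes i j i≢j x

count-coord-false : (n : ℕ) (i : Fin n) →
  count n (λ x → not (lookup x i)) + count n (λ x → not (lookup x i)) ≡ 2 ^ n
count-coord-false n i = trans (cong₂ _+_ as-xor as-xor)
  (trans (count-disagree-half n (flipAt i) (flipAt-involutive i) (λ _ → true) (λ x → lookup x i) (λ _ → true)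
                              (λ _ → refl) (λ x _ → flipAt-same i x) (λ _ _ → refl))
         (count-true n))
  where
  as-xor : count n (λ x → not (lookup x i)) ≡ count n (λ x → true ∧ (lookup x i xor true))
  as-xor = count-cong n (λ x → sym (xor-comm (lookup x i) true))

<⇒<ᵇ≡true : ∀ {a b} → a < b → (a <ᵇ b) ≡ true
<⇒<ᵇ≡true p = Equivalence.to T-≡ (<⇒<ᵇ p)

<ᵇ≡true⇒< : ∀ a b → (a <ᵇ b) ≡ true → a < b
<ᵇ≡true⇒< a b e = <ᵇ⇒< a b (Equivalence.from T-≡ e)

≮⇒<ᵇ≡false : ∀ {a b} → ¬ (a < b) → (a <ᵇ b) ≡ false
≮⇒<ᵇ≡false {a} {b} a≮b with a <ᵇ b in e
... | false = refl
... | true  = ⊥-elim (a≮b (<ᵇ≡true⇒< a b e))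

val : (m : ℕ) → (Fin m → Bool) → ℕ
val m b = foldr (λ k s → (if b k then 2 ^ toℕ k else 0) + s) 0 (allFin m)

val≡sumFin : (m : ℕ) (b : Fin m → Bool) → val m b ≡ sumFin m (λ k → if b k then 2 ^ toℕ k else 0)
val≡sumFin m b = trans (foldr≡sumL (allFin m)) (sumL-tabulate m (λ k → k) _)
  where
  foldr≡sumL : (L : List (Fin m)) → foldr (λ k s → (if b k then 2 ^ toℕ k else 0) + s) 0 L
                                    ≡ sumL L (λ k → if b k then 2 ^ toℕ k else 0)
  foldr≡sumL []      = refl
  foldr≡sumL (k ∷ L) = cong (_ +_) (foldr≡sumL L)

val-cong : (m : ℕ) {b c : Fin m → Bool} → (∀ k → b k ≡ c k) → val m b ≡ val m c
val-cong m {b} {c} e = trans (val≡sumFin m b)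
  (trans (sumFin-cong m (λ k → cong (λ z → if z then 2 ^ toℕ k else 0) (e k))) (sym (val≡sumFin m c)))

val-suc : (m : ℕ) (b : Fin (suc m) → Bool) → val (suc m) b ≡ 𝟙 (b zero) + 2 * val m (λ k → b (suc k))
val-suc m b = begin
  val (suc m) b
    ≡⟨ val≡sumFin (suc m) b ⟩
  (if b zero then 1 else 0) + sumFin m (λ k → if b (suc k) then 2 * 2 ^ toℕ k else 0)
    ≡⟨ cong₂ _+_ (bit-1 (b zero)) (sumFin-cong m (λ k → bit-double (b (suc k)) _)) ⟩
  𝟙 (b zero) + sumFin m (λ k → 2 * (if b (suc k) then 2 ^ toℕ k else 0))
    ≡⟨ cong (𝟙 (b zero) +_) (trans (sumFin-*ˡ m 2 _) (cong (2 *_) (sym (val≡sumFin m (λ k → b (suc k)))))) ⟩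
  𝟙 (b zero) + 2 * val m (λ k → b (suc k)) ∎
  where
  open ≡-Reasoning
  bit-1 : ∀ c → (if c then 1 else 0) ≡ 𝟙 c
  bit-1 true  = refl
  bit-1 false = refl
  bit-double : ∀ c p → (if c then 2 * p else 0) ≡ 2 * (if c then p else 0)
  bit-double true  p = refl
  bit-double false p = refl

𝟙+2*<2* : ∀ c v P → v < P → 𝟙 c + 2 * v < 2 * P
𝟙+2*<2* c v P v<P = begin-strict
  𝟙 c + 2 * v  ≤⟨ +-monoˡ-≤ (2 * v) (𝟙≤1 c) ⟩
  1 + 2 * v    <⟨ n<1+n _ ⟩
  2 + 2 * v    ≡⟨ sym (*-distribˡ-+ 2 1 v) ⟩
  2 * (1 + v)  ≤⟨ *-monoʳ-≤ 2 v<P ⟩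
  2 * P        ∎
  where open ≤-Reasoning

val-bound : (m : ℕ) (b : Fin m → Bool) → val m b < 2 ^ m
val-bound zero    b = s≤s z≤n
val-bound (suc m) b = subst (_< 2 ^ suc m) (sym (val-suc m b))
  (𝟙+2*<2* (b zero) _ _ (val-bound m (λ k → b (suc k))))

<ᵇ-double : ∀ c v P → (𝟙 c + 2 * v <ᵇ 2 * P) ≡ (v <ᵇ P)
<ᵇ-double c v P = ⇔→≡ {z = true} (mk⇔
  (λ e → <⇒<ᵇ≡true (*-cancelˡ-< 2 v P (≤-<-trans (m≤n+m (2 * v) (𝟙 c)) (<ᵇ≡true⇒< _ _ e))))
  (λ e → <⇒<ᵇ≡true (𝟙+2*<2* c v P (<ᵇ≡true⇒< _ _ e))))

val-top : (m : ℕ) (b : Fin (suc m) → Bool) → (val (suc m) b <ᵇ 2 ^ m) ≡ not (b (fromℕ m))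
val-top zero    b rewrite val-suc zero b with b zero
... | true  = refl
... | false = refl
val-top (suc m) b = trans (cong (_<ᵇ 2 ^ suc m) (val-suc (suc m) b))
  (trans (<ᵇ-double (b zero) (val (suc m) (λ j → b (suc j))) (2 ^ m)) (val-top m (λ j → b (suc j))))

sumInputs-val : (m : ℕ) (G : ℕ → ℕ) → sumL (allInputs m) (λ t → G (val m (lookup t))) ≡ sumN (2 ^ m) G
sumInputs-val zero    G = refl
sumInputs-val (suc m) G = begin
  sumL (allInputs (suc m)) (λ t → G (val (suc m) (lookup t)))
    ≡⟨ sumInputs-suc m _ ⟩
  sumL I (λ t → G (val (suc m) (lookup (false ∷ t)))) + sumL I (λ t → G (val (suc m) (lookup (true ∷ t))))
    ≡⟨ cong₂ _+_ (sumL-cong I (λ t → cong G (val-suc m (lookup (false ∷ t)))))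
                 (sumL-cong I (λ t → cong G (val-suc m (lookup (true ∷ t))))) ⟩
  sumL I (λ t → G (2 * val m (lookup t))) + sumL I (λ t → G (suc (2 * val m (lookup t))))
    ≡⟨ cong₂ _+_ (sumInputs-val m (λ i → G (2 * i))) (sumInputs-val m (λ i → G (suc (2 * i)))) ⟩
  sumN (2 ^ m) (λ i → G (2 * i)) + sumN (2 ^ m) (λ i → G (suc (2 * i)))
    ≡⟨ sym (sumN-even-odd (2 ^ m) G) ⟩
  sumN (2 ^ m + 2 ^ m) G
    ≡⟨ cong (λ z → sumN (2 ^ m + z) G) (sym (+-identityʳ _)) ⟩
  sumN (2 ^ suc m) G ∎
  where
  open ≡-Reasoning
  I = allInputs m

-- Fibres of x ↦ (x σ(0), …, x σ(m-1)) for an injective σ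

matches : {n : ℕ} (m : ℕ) → (Fin m → Fin n) → (Fin m → Bool) → Input n → Bool
matches zero    σ b x = true
matches (suc m) σ b x = eqᵇ (lookup x (σ zero)) (b zero) ∧ matches m (λ k → σ (suc k)) (λ k → b (suc k)) x

matches-flipAt : {n : ℕ} (m : ℕ) (σ : Fin m → Fin n) (b : Fin m → Bool) (j : Fin n) → (∀ k → j ≢ σ k) →
  ∀ x → matches m σ b (flipAt j x) ≡ matches m σ b x
matches-flipAt zero    σ b j h x = refl
matches-flipAt (suc m) σ b j h x =
  cong₂ _∧_ (cong (λ z → eqᵇ z (b zero)) (flipAt-other j (σ zero) x (h zero)))
            (matches-flipAt m (λ k → σ (suc k)) (λ k → b (suc k)) j (λ k → h (suc k)) x)

count-matches : (n m : ℕ) (σ : Fin m → Fin n) → Injective _≡_ _≡_ σ → (b : Fin m → Bool) →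
  count n (matches m σ b) * 2 ^ m ≡ 2 ^ n
count-matches n zero    σ inj b = trans (*-identityʳ _) (count-true n)
count-matches n (suc m) σ inj b = begin
  count n P * (2 * 2 ^ m)             ≡⟨ regroup (count n P) (2 ^ m) ⟩
  (count n P + count n P) * 2 ^ m     ≡⟨ cong (_* 2 ^ m) (trans (cong₂ _+_ as-xor as-xor) halves) ⟩
  count n R * 2 ^ m                   ≡⟨ count-matches n m σ′ (λ e → suc-injective (inj e)) b′ ⟩
  2 ^ n ∎
  where
  open ≡-Reasoning
  regroup : ∀ c p → c * (2 * p) ≡ (c + c) * p
  regroup = solve-∀
  σ′ : Fin m → Fin n
  σ′ k = σ (suc k)
  b′ : Fin m → Bool
  b′ k = b (suc k)
  P R : Input n → Bool
  P = matches (suc m) σ b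
  R = matches m σ′ b′
  j : Fin n
  j = σ zero
  eqᵇ-as-xor : ∀ l c → eqᵇ l c ≡ (l xor not c)
  eqᵇ-as-xor true  true  = refl
  eqᵇ-as-xor true  false = refl
  eqᵇ-as-xor false true  = refl
  eqᵇ-as-xor false false = refl
  as-xor : count n P ≡ count n (λ x → R x ∧ (lookup x j xor not (b zero)))
  as-xor = count-cong n (λ x → trans (∧-comm (eqᵇ (lookup x j) (b zero)) (R x))
                                     (cong (R x ∧_) (eqᵇ-as-xor (lookup x j) (b zero))))
  halves : count n (λ x → R x ∧ (lookup x j xor not (b zero))) + count n (λ x → R x ∧ (lookup x j xor not (b zero)))
         ≡ count n R
  halves = count-disagree-half n (flipAt j) (flipAt-involutive j) R (λ x → lookup x j) (λ _ → not (b zero))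
             (matches-flipAt m σ′ b′ j (λ k eq → 0≢suc (inj eq))) (λ x _ → flipAt-same j x) (λ _ _ → refl)
    where
    0≢suc : ∀ {k : Fin m} → zero ≢ suc k
    0≢suc ()

matches-eqᵛ : {n : ℕ} (m : ℕ) (σ : Fin m → Fin n) (t : Vec Bool m) (x : Input n) →
  matches m σ (lookup t) x ≡ eqᵛ (Vec.tabulate (λ k → lookup x (σ k))) t
matches-eqᵛ zero    σ []      x = refl
matches-eqᵛ (suc m) σ (a ∷ t) x = cong (eqᵇ (lookup x (σ zero)) a ∧_) (matches-eqᵛ m (λ k → σ (suc k)) t x)

fibreSize : (n m : ℕ) (σ : Fin m → Fin n) → ℕ
fibreSize n m σ = count n (matches m σ (λ _ → false))

fibreSize-*-2^m : (n m : ℕ) (σ : Fin m → Fin n) → Injective _≡_ _≡_ σ → fibreSize n m σ * 2 ^ m ≡ 2 ^ n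
fibreSize-*-2^m n m σ inj = count-matches n m σ inj (λ _ → false)

sumInputs-by-fibres : (n m : ℕ) (σ : Fin m → Fin n) → Injective _≡_ _≡_ σ → (G : ℕ → ℕ) →
  sumL (allInputs n) (λ x → G (val m (λ k → lookup x (σ k)))) ≡ fibreSize n m σ * sumN (2 ^ m) G
sumInputs-by-fibres n m σ inj G = begin
  sumL In (λ x → G (val m (λ k → lookup x (σ k))))
    ≡⟨ sumL-cong In (λ x → sym (trans (sumInputs-delta m (bits x) F) (cong G (val-cong m (lookup∘tabulate _))))) ⟩
  sumL In (λ x → sumL Im (λ t → 𝟙 (eqᵛ (bits x) t) * F t))
    ≡⟨ sumL-swap In Im _ ⟩
  sumL Im (λ t → sumL In (λ x → 𝟙 (eqᵛ (bits x) t) * F t))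
    ≡⟨ sumL-cong Im (λ t → trans (sumL-cong In (λ x → *-comm _ (F t))) (sumL-*ˡ In (F t) _)) ⟩
  sumL Im (λ t → F t * count n (λ x → eqᵛ (bits x) t))
    ≡⟨ sumL-cong Im (λ t → trans (cong (F t *_) (fibre t)) (*-comm (F t) s)) ⟩
  sumL Im (λ t → s * F t)
    ≡⟨ trans (sumL-*ˡ Im s F) (cong (s *_) (sumInputs-val m G)) ⟩
  s * sumN (2 ^ m) G ∎
  where
  open ≡-Reasoning
  In = allInputs n
  Im = allInputs m
  bits : Input n → Vec Bool m
  bits x = Vec.tabulate (λ k → lookup x (σ k))
  F : Vec Bool m → ℕ
  F t = G (val m (lookup t))
  s = fibreSize n m σ
  fibre : ∀ t → count n (λ x → eqᵛ (bits x) t) ≡ s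
  fibre t = *-cancelʳ-≡ _ _ (2 ^ m) {{m^n≢0 2 m}}
    (trans (cong (_* 2 ^ m) (sym (count-cong n (matches-eqᵛ m σ t))))
           (trans (count-matches n m σ inj (lookup t)) (sym (fibreSize-*-2^m n m σ inj))))

parity : (m : ℕ) → (Fin m → Bool) → Bool
parity zero    w = false
parity (suc m) w = w zero xor parity m (λ k → w (suc k))

parity-cong : (m : ℕ) {w w′ : Fin m → Bool} → (∀ k → w k ≡ w′ k) → parity m w ≡ parity m w′
parity-cong zero    e = refl
parity-cong (suc m) e = cong₂ _xor_ (e zero) (parity-cong m (λ k → e (suc k)))

parity-negate-one : (m : ℕ) (i : Fin m) {w w′ : Fin m → Bool} →
  (∀ k → k ≢ i → w′ k ≡ w k) → w′ i ≡ not (w i) → parity m w′ ≡ not (parity m w)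
parity-negate-one (suc m) zero    {w} h hi =
  trans (cong₂ _xor_ hi (parity-cong m (λ k → h (suc k) (λ ())))) (sym (not-distribˡ-xor (w zero) _))
parity-negate-one (suc m) (suc i) {w} h hi =
  trans (cong₂ _xor_ (h zero (λ ())) (parity-negate-one m i (λ k k≢i → h (suc k) (λ e → k≢i (suc-injective e))) hi))
        (sym (not-distribʳ-xor (w zero) _))

parityOn≡parity : {n : ℕ} (M : Subset n) (x : Input n) → parityOn M x ≡ parity n (λ ℓ → lookup M ℓ ∧ lookup x ℓ)
parityOn≡parity {n} M x = foldr≡parity id
  where
  foldr≡parity : ∀ {m} (f : Fin m → Fin n) → foldr (λ ℓ b → (lookup M ℓ ∧ lookup x ℓ) xor b) false (tabulate f)
                                            ≡ parity m (λ k → lookup M (f k) ∧ lookup x (f k))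
  foldr≡parity {zero}  f = refl
  foldr≡parity {suc m} f = cong (lookup M (f zero) ∧ lookup x (f zero) xor_) (foldr≡parity (λ k → f (suc k)))

parityOn-cong : {n : ℕ} (M : Subset n) (x y : Input n) → (∀ ℓ → lookup M ℓ ≡ true → lookup x ℓ ≡ lookup y ℓ) →
  parityOn M x ≡ parityOn M y
parityOn-cong {n} M x y h = trans (parityOn≡parity M x) (trans (parity-cong n agree) (sym (parityOn≡parity M y)))
  where
  agree : ∀ ℓ → (lookup M ℓ ∧ lookup x ℓ) ≡ (lookup M ℓ ∧ lookup y ℓ)
  agree ℓ with lookup M ℓ in e
  ... | true  = h ℓ e
  ... | false = refl

parityOn-flipAt-∈ : {n : ℕ} (M : Subset n) (i : Fin n) → lookup M i ≡ true → (x : Input n) →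
  parityOn M (flipAt i x) ≡ not (parityOn M x)
parityOn-flipAt-∈ {n} M i Mi x = trans (parityOn≡parity M (flipAt i x)) (trans
  (parity-negate-one n i (λ k k≢i → cong (lookup M k ∧_) (flipAt-other i k x (λ e → k≢i (sym e))))
                         (trans (cong (lookup M i ∧_) (flipAt-same i x))
                                (trans (cong (λ c → c ∧ not (lookup x i)) Mi) (cong (λ c → not (c ∧ lookup x i)) (sym Mi)))))
  (cong not (sym (parityOn≡parity M x))))

parityOn-flipAt-∉ : {n : ℕ} (M : Subset n) (i : Fin n) → lookup M i ≡ false → (x : Input n) →
  parityOn M (flipAt i x) ≡ parityOn M x
parityOn-flipAt-∉ M i Mi x = parityOn-cong M (flipAt i x) x
  (λ ℓ Mℓ → flipAt-other i ℓ x (λ { refl → true≢false (trans (sym Mℓ) Mi) }))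

lookup-∁ : {n : ℕ} (p : Subset n) (i : Fin n) → lookup (∁ p) i ≡ not (lookup p i)
lookup-∁ p i = lookup-map i not p

∁-true⇒false : {n : ℕ} (p : Subset n) (i : Fin n) → lookup (∁ p) i ≡ true → lookup p i ≡ false
∁-true⇒false p i e = not-injective (trans (sym (lookup-∁ p i)) e)

IsEdge : {n : ℕ} → Graph n → Fin n × Fin n → Set
IsEdge G (i , j) = (G i j ≡ true) × (toℕ i < toℕ j)

edges-valid : {n : ℕ} (G : Graph n) → All (IsEdge G) (edges G)
edges-valid {n} G = All-concatMap (allFin n) (λ i → All-concatMap (allFin n) (valid i))
  where
  All-concatMap : ∀ {P : Fin n × Fin n → Set} {f : Fin n → List (Fin n × Fin n)} (L : List (Fin n)) →
    (∀ a → All P (f a)) → All P (concatMap f L)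
  All-concatMap L h = AllP.concat⁺ (AllP.map⁺ (All.universal h L))
  valid : ∀ i j → All (IsEdge G) (if G i j ∧ (toℕ i <ᵇ toℕ j) then [ (i , j) ] else [])
  valid i j with G i j in e | toℕ i <ᵇ toℕ j in e′
  ... | true  | true  = (e , <ᵇ≡true⇒< _ _ e′) ∷ []
  ... | true  | false = []
  ... | false | _     = []

edge : {n : ℕ} (G : Graph n) → Fin (numEdges G) → Fin n × Fin n
edge G = List.lookup (edges G)

edge-valid : {n : ℕ} (G : Graph n) (e : Fin (numEdges G)) → IsEdge G (edge G e)
edge-valid G e = All.lookup (edges-valid G) (∈-lookup e)

EdgeOutside : {n : ℕ} → Subset n → Fin n × Fin n → Set
EdgeOutside M (i , j) = (lookup M i ≡ false) × (lookup M j ≡ false)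

edge-outside : {n : ℕ} (M : Subset n) (G : Graph n) → IsGraphOn (∁ M) G → (e : Fin n × Fin n) →
  IsEdge G e → EdgeOutside M e
edge-outside M G (_ , _ , inside) (i , j) (Gij , _) =
  ∁-true⇒false M i (proj₁ (inside i j Gij)) , ∁-true⇒false M j (proj₂ (inside i j Gij))

touches : {n : ℕ} (G : Graph n) → Subset n → Fin (numEdges G) → Bool
touches G T e = lookup T (proj₁ (edge G e)) ∨ lookup T (proj₂ (edge G e))

numTouching : {n : ℕ} (G : Graph n) → Subset n → ℕ
numTouching G T = sumFin (numEdges G) (λ e → 𝟙 (touches G T e))

numTouching≤numEdges : {n : ℕ} (G : Graph n) (T : Subset n) → numTouching G T ≤ numEdges G
numTouching≤numEdges G T = subst (numTouching G T ≤_) (trans (sumFin-const (numEdges G) 1) (*-identityʳ _))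
  (sumFin-mono (numEdges G) (λ e → 𝟙≤1 (touches G T e)))

sumL-edges-outside : {n : ℕ} (M : Subset n) (G : Graph n) → IsGraphOn (∁ M) G → {F F′ : Fin n × Fin n → ℕ} →
  (∀ e → EdgeOutside M e → F e ≡ F′ e) → sumL (edges G) F ≡ sumL (edges G) F′
sumL-edges-outside {n} M G G-on {F} {F′} h = go (edges G) (edges-valid G)
  where
  go : (L : List (Fin n × Fin n)) → All (IsEdge G) L → sumL L F ≡ sumL L F′
  go []      []         = refl
  go (e ∷ L) (ok ∷ oks) = cong₂ _+_ (h e (edge-outside M G G-on e ok)) (go L oks)

chiNumerator≡numTouching : {n : ℕ} (M : Subset n) (G : Graph n) → IsGraphOn (∁ M) G → (T : Subset n) →
  (∀ i → lookup T i ≡ true → lookup M i ≡ false) → E G T T + E G T (∁ M ∩ ∁ T) ≡ numTouching G T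
chiNumerator≡numTouching {n} M G G-on T T∩M=∅ = begin
  E G T T + E G T (∁ M ∩ ∁ T)
    ≡⟨ cong₂ _+_ (countᵇ≡sumL _ (edges G)) (countᵇ≡sumL _ (edges G)) ⟩
  sumL (edges G) (λ e → 𝟙 (inside e)) + sumL (edges G) (λ e → 𝟙 (across e))
    ≡⟨ sym (sumL-+ (edges G) _ _) ⟩
  sumL (edges G) (λ e → 𝟙 (inside e) + 𝟙 (across e))
    ≡⟨ sumL-edges-outside M G G-on split ⟩
  sumL (edges G) (λ e → 𝟙 (lookup T (proj₁ e) ∨ lookup T (proj₂ e)))
    ≡⟨ sumL-lookup (edges G) _ ⟩
  numTouching G T ∎
  where
  open ≡-Reasoning
  R = ∁ M ∩ ∁ T
  inside across : Fin n × Fin n → Bool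
  inside (i , j) = (lookup T i ∧ lookup T j) ∨ (lookup T i ∧ lookup T j)
  across (i , j) = (lookup T i ∧ lookup R j) ∨ (lookup R i ∧ lookup T j)
  lookup-R : ∀ i → lookup M i ≡ false → lookup R i ≡ not (lookup T i)
  lookup-R i Mi = trans (lookup-zipWith _∧_ i (∁ M) (∁ T))
                        (cong₂ _∧_ (trans (lookup-∁ M i) (cong not Mi)) (lookup-∁ T i))
  split : ∀ e → EdgeOutside M e → 𝟙 (inside e) + 𝟙 (across e) ≡ 𝟙 (lookup T (proj₁ e) ∨ lookup T (proj₂ e))
  split (i , j) (Mi , Mj) rewrite lookup-R i Mi | lookup-R j Mj with lookup T i | lookup T j
  ... | true  | true  = refl
  ... | true  | false = refl
  ... | false | true  = refl
  ... | false | false = refl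

E-∁M-∁M≡numEdges : {n : ℕ} (M : Subset n) (G : Graph n) → IsGraphOn (∁ M) G → E G (∁ M) (∁ M) ≡ numEdges G
E-∁M-∁M≡numEdges M G G-on = trans (countᵇ≡sumL _ (edges G))
  (trans (sumL-edges-outside M G G-on both-outside) (trans (sumL-const (edges G) 1) (*-identityˡ _)))
  where
  both-outside : ∀ e → EdgeOutside M e →
    𝟙 ((lookup (∁ M) (proj₁ e) ∧ lookup (∁ M) (proj₂ e)) ∨ (lookup (∁ M) (proj₁ e) ∧ lookup (∁ M) (proj₂ e))) ≡ 1
  both-outside (i , j) (Mi , Mj) rewrite lookup-∁ M i | lookup-∁ M j | Mi | Mj = refl

length-concatMap : (f : A → List B) (L : List A) → length (concatMap f L) ≡ sumL L (λ a → length (f a))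
length-concatMap f []      = refl
length-concatMap f (x ∷ L) = trans (length-++ (f x)) (cong (length (f x) +_) (length-concatMap f L))

numEdges≤n² : {n : ℕ} (G : Graph n) → numEdges G ≤ n * n
numEdges≤n² {n} G = begin
  numEdges G                               ≡⟨ length-concatMap _ (allFin n) ⟩
  sumL (allFin n) (λ i → length (row i))   ≤⟨ sumL-mono (allFin n) row-length ⟩
  sumL (allFin n) (λ _ → n)                ≡⟨ trans (sumL-const (allFin n) n) (cong (n *_) (length-tabulate id)) ⟩
  n * n                                    ∎
  where
  open ≤-Reasoning
  entry : Fin n → Fin n → List (Fin n × Fin n)
  entry i j = if G i j ∧ (toℕ i <ᵇ toℕ j) then [ (i , j) ] else []
  row : Fin n → List (Fin n × Fin n)
  row i = concatMap (entry i) (allFin n)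
  entry-length : ∀ i j → length (entry i j) ≤ 1
  entry-length i j with G i j ∧ (toℕ i <ᵇ toℕ j)
  ... | true  = ≤-refl
  ... | false = z≤n
  row-length : ∀ i → length (row i) ≤ n
  row-length i = begin
    length (row i)                    ≡⟨ length-concatMap _ (allFin n) ⟩
    sumL (allFin n) (λ j → length (entry i j)) ≤⟨ sumL-mono (allFin n) (entry-length i) ⟩
    sumL (allFin n) (λ _ → 1)         ≡⟨ trans (sumL-const (allFin n) 1) (trans (*-identityˡ _) (length-tabulate id)) ⟩
    n                                 ∎

chiFrac≡ : {n : ℕ} (M : Subset n) (G : Graph n) → IsGraphOn (∁ M) G → (T : Subset n) → ChiAdmissible M T →
  chiFrac M G T ≡ frac (numTouching G T) (numEdges G)
chiFrac≡ M G G-on T (T∩M=∅ , _) =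
  cong₂ frac (chiNumerator≡numTouching M G G-on T T∩M=∅) (E-∁M-∁M≡numEdges M G G-on)

allVecs-complete : (xs : List A) → (∀ a → a ∈ xs) → (n : ℕ) → (v : Vec A n) → v ∈ allVecs xs n
allVecs-complete xs complete zero    []      = here refl
allVecs-complete xs complete (suc n) (a ∷ v) = ∈-concatMap⁺ (λ b → map (b ∷_) (allVecs xs n))
  (Any.map (λ { refl → ∈-map⁺ (a ∷_) (allVecs-complete xs complete n v) }) (complete a))

∈-allInputs : (n : ℕ) (x : Input n) → x ∈ allInputs n
∈-allInputs n x = allVecs-complete _ (λ { false → here refl ; true → there (here refl) }) n x

allVecs-unique : (xs : List A) → Unique xs → (n : ℕ) → Unique (allVecs xs n)
allVecs-unique xs xs! zero    = [] ∷ []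
allVecs-unique {A} xs xs! (suc n) = prepend-unique xs xs!
  where
  L : List (Vec A n)
  L = allVecs xs n
  L! : Unique L
  L! = allVecs-unique xs xs! n
  prepend-unique : (ys : List A) → Unique ys → Unique (concatMap (λ a → map (a ∷_) L) ys)
  prepend-unique []       _           = []
  prepend-unique (a ∷ ys) (a∉ys ∷ ys!) =
    UniqueP.++⁺ (UniqueP.map⁺ ∷-injectiveʳ L!) (prepend-unique ys ys!) (λ (v∈₁ , v∈₂) → disjoint v∈₁ v∈₂)
    where
    disjoint : ∀ {v} → v ∈ map (a ∷_) L → v ∈ concatMap (λ b → map (b ∷_) L) ys → ⊥
    disjoint v∈₁ v∈₂ with ∈-map⁻ (a ∷_) v∈₁
    ... | w , _ , refl with ∈-concatMap⁻ (λ b → map (b ∷_) L) {xs = ys} v∈₂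
    ... | b∈ = other-heads ys a∉ys b∈
      where
      other-heads : (zs : List A) → All (a ≢_) zs → Any (λ b → (a ∷ w) ∈ map (b ∷_) L) zs → ⊥
      other-heads (z ∷ zs) (a≢z ∷ _)   (here p)  with ∈-map⁻ (z ∷_) p
      ... | _ , _ , e = a≢z (∷-injectiveˡ e)
      other-heads (z ∷ zs) (_   ∷ a≢s) (there p) = other-heads zs a≢s p

argmin : (L : List A) (F : A → ℕ) (d : A) → Σ A λ y → (F y ≤ F d) × (∀ z → z ∈ L → F y ≤ F z)
argmin []      F d = d , ≤-refl , λ z ()
argmin (x ∷ L) F d with argmin L F d
... | y , Fy≤Fd , y-min with F x ≤? F y
...   | yes Fx≤Fy = x , ≤-trans Fx≤Fy Fy≤Fd , λ { z (here refl) → ≤-refl ; z (there z∈) → ≤-trans Fx≤Fy (y-min z z∈) }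
...   | no  Fx≰Fy = y , Fy≤Fd , λ { z (here refl) → <⇒≤ (≰⇒> Fx≰Fy) ; z (there z∈) → y-min z z∈ }

length-filter+rejected : {P : A → Set} (P? : (x : A) → Dec (P x)) (L : List A) →
  length (List.filter P? L) + sumL L (λ x → 𝟙 (not (does (P? x)))) ≡ sumL L (λ _ → 1)
length-filter+rejected P? []      = refl
length-filter+rejected P? (x ∷ L) with P? x
... | yes _ = cong suc (length-filter+rejected P? L)
... | no  _ = trans (+-suc _ _) (cong suc (length-filter+rejected P? L))

scaled-𝟙-rejected≤ : {P : Set} (P? : Dec P) {c x : ℕ} → (¬ P → c ≤ x) → c * 𝟙 (not (does P?)) ≤ x
scaled-𝟙-rejected≤ (yes _)  {c} {x} _ = subst (_≤ x) (sym (*-zeroʳ c)) z≤n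
scaled-𝟙-rejected≤ (no ¬p) {c} {x} h = subst (_≤ x) (sym (*-identityʳ c)) (h ¬p)

𝟙-rejected-all≤ : (m : ℕ) {P : Fin m → Set} (P? : (i : Fin m) → Dec (P i)) →
  𝟙 (not (does (all? P?))) ≤ sumFin m (λ i → 𝟙 (not (does (P? i))))
𝟙-rejected-all≤ m {P} P? = bound (all? P?)
  where
  bound : (all-P? : Dec (∀ i → P i)) → 𝟙 (not (does all-P?)) ≤ sumFin m (λ i → 𝟙 (not (does (P? i))))
  bound (yes _)   = z≤n
  bound (no ¬all) with ¬∀⟶∃¬ m P P? ¬all
  ... | i , ¬Pi = ≤-trans (≤-reflexive (cong (λ b → 𝟙 (not b)) (sym (dec-false (P? i) ¬Pi))))
                          (sumFin-≥ m (λ i → 𝟙 (not (does (P? i)))) i)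

0<* : ∀ {a b} → 0 < a → 0 < b → 0 < a * b
0<* = *-mono-<

toℚᵘ-frac : ∀ a b → toℚᵘ (frac a (suc b)) ℚᵘ.≃ mkℚᵘ (ℤ.+ a) b
toℚᵘ-frac a b = ℚP.toℚᵘ-fromℚᵘ (mkℚᵘ (ℤ.+ a) b)

frac-≤ : ∀ a b c d → 0 < b → 0 < d → a * d ≤ c * b → frac a b ℚ.≤ frac c d
frac-≤ a (suc b) c (suc d) _ _ h = ℚP.toℚᵘ-cancel-≤
  (ℚᵘP.≤-respˡ-≃ (ℚᵘP.≃-sym (toℚᵘ-frac a b)) (ℚᵘP.≤-respʳ-≃ (ℚᵘP.≃-sym (toℚᵘ-frac c d))
    (ℚᵘ.*≤* (subst₂ ℤ._≤_ (ℤP.pos-* a (suc d)) (ℤP.pos-* c (suc b)) (ℤ.+≤+ h)))))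

frac-monoˡ-≤ : ∀ b {a c} → a ≤ c → frac a b ℚ.≤ frac c b
frac-monoˡ-≤ zero    h = ℚP.≤-refl
frac-monoˡ-≤ (suc b) {a} {c} h = frac-≤ a (suc b) c (suc b) (s≤s z≤n) (s≤s z≤n) (*-monoˡ-≤ (suc b) h)

frac-cong : ∀ a b c d → 0 < b → 0 < d → a * d ≡ c * b → frac a b ≡ frac c d
frac-cong a b c d 0<b 0<d e =
  ℚP.≤-antisym (frac-≤ a b c d 0<b 0<d (≤-reflexive e)) (frac-≤ c d a b 0<d 0<b (≤-reflexive (sym e)))

frac-+-frac : ∀ a b c d → 0 < b → 0 < d → frac a b ℚ.+ frac c d ≡ frac (a * d + c * b) (b * d)
frac-+-frac a (suc b) c (suc d) _ _ = ℚP.toℚᵘ-injective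
  (ℚᵘP.≃-trans (ℚP.toℚᵘ-homo-+ (frac a (suc b)) (frac c (suc d)))
  (ℚᵘP.≃-trans (ℚᵘP.+-cong (toℚᵘ-frac a b) (toℚᵘ-frac c d))
  (ℚᵘP.≃-trans (ℚᵘP.≃-reflexive (cong (λ z → mkℚᵘ z _) numerator))
               (ℚᵘP.≃-sym (toℚᵘ-frac (a * suc d + c * suc b) _)))))
  where
  numerator : ℤ.+ a ℤ.* ℤ.+ suc d ℤ.+ ℤ.+ c ℤ.* ℤ.+ suc b ≡ ℤ.+ (a * suc d + c * suc b)
  numerator = trans (cong₂ ℤ._+_ (sym (ℤP.pos-* a (suc d))) (sym (ℤP.pos-* c (suc b)))) (sym (ℤP.pos-+ (a * suc d) (c * suc b)))

frac-*-frac : ∀ a b c d → 0 < b → 0 < d → frac a b ℚ.* frac c d ≡ frac (a * c) (b * d)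
frac-*-frac a (suc b) c (suc d) _ _ = ℚP.toℚᵘ-injective
  (ℚᵘP.≃-trans (ℚP.toℚᵘ-homo-* (frac a (suc b)) (frac c (suc d)))
  (ℚᵘP.≃-trans (ℚᵘP.*-cong (toℚᵘ-frac a b) (toℚᵘ-frac c d))
  (ℚᵘP.≃-trans (ℚᵘP.≃-reflexive (cong (λ z → mkℚᵘ z _) (sym (ℤP.pos-* a c)))) (ℚᵘP.≃-sym (toℚᵘ-frac (a * c) _)))))

≤+⇒-≤ : ∀ p r s → p ℚ.≤ s ℚ.+ r → p ℚ.- r ℚ.≤ s
≤+⇒-≤ p r s h = ℚP.≤-trans (ℚP.+-monoˡ-≤ (ℚ.- r) h) (ℚP.≤-reflexive
  (trans (ℚP.+-assoc s r (ℚ.- r)) (trans (cong (s ℚ.+_) (ℚP.+-inverseʳ r)) (ℚP.+-identityʳ s))))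

1/q≤ε : (ε : ℚ) → 0ℚ ℚ.< ε → Σ ℕ λ q → (0 < q) × (frac 1 q ℚ.≤ ε)
1/q≤ε (ℚ.mkℚ (ℤ.+ suc p) d _) _ = suc d , s≤s z≤n ,
  ℚP.toℚᵘ-cancel-≤ (ℚᵘP.≤-respˡ-≃ (ℚᵘP.≃-sym (toℚᵘ-frac 1 d))
    (ℚᵘ.*≤* (subst₂ ℤ._≤_ (ℤP.pos-* 1 (suc d)) (ℤP.pos-* (suc p) (suc d)) (ℤ.+≤+ (*-monoˡ-≤ (suc d) {1} {suc p} (s≤s z≤n))))))
1/q≤ε (ℚ.mkℚ (ℤ.+ zero) _ _)    (ℚ.*<* (ℤ.+<+ ()))
1/q≤ε (ℚ.mkℚ ℤ.-[1+ _ ] _ _)  (ℚ.*<* ())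

-- With N/E = chiFrac and X/(4K) = the distance, both estimates reduce to |E X - K N| ≤ K E / q up to a factor.
frac-≤-quarter+1/q : ∀ X N E K q → 0 < E → 0 < K → 0 < q →
  q * E * X ≤ q * K * N + K * E → frac X (4 * K) ℚ.≤ frac N E ℚ.* frac 1 4 ℚ.+ frac 1 q
frac-≤-quarter+1/q X N E K q 0<E 0<K 0<q h = ℚP.≤-trans
  (frac-≤ X (4 * K) (N * 1 * q + 1 * (E * 4)) (E * 4 * q) (0<* {4} (s≤s z≤n) 0<K) (0<* 0<E4 0<q) cross)
  (ℚP.≤-reflexive (sym (trans (cong (ℚ._+ frac 1 q) (frac-*-frac N E 1 4 0<E (s≤s z≤n))) (frac-+-frac (N * 1) (E * 4) 1 q 0<E4 0<q))))
  where
  0<E4 : 0 < E * 4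
  0<E4 = 0<* 0<E (s≤s z≤n)
  cross : X * (E * 4 * q) ≤ (N * 1 * q + 1 * (E * 4)) * (4 * K)
  cross = begin
    X * (E * 4 * q)                           ≡⟨ e₁ X E q ⟩
    4 * (q * E * X)                           ≤⟨ *-monoʳ-≤ 4 h ⟩
    4 * (q * K * N + K * E)                   ≤⟨ ≤-reflexive (e₂ q K N E) ⟩
    4 * (q * K * N) + 4 * (K * E)             ≤⟨ +-monoʳ-≤ (4 * (q * K * N)) (m≤m+n (4 * (K * E)) (12 * (K * E))) ⟩
    4 * (q * K * N) + (4 * (K * E) + 12 * (K * E)) ≡⟨ e₃ N q E K ⟩
    (N * 1 * q + 1 * (E * 4)) * (4 * K)       ∎
    where
    open ≤-Reasoning
    e₁ : ∀ X E q → X * (E * 4 * q) ≡ 4 * (q * E * X)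
    e₁ = solve-∀
    e₂ : ∀ q K N E → 4 * (q * K * N + K * E) ≡ 4 * (q * K * N) + 4 * (K * E)
    e₂ = solve-∀
    e₃ : ∀ N q E K → 4 * (q * K * N) + (4 * (K * E) + 12 * (K * E)) ≡ (N * 1 * q + 1 * (E * 4)) * (4 * K)
    e₃ = solve-∀

quarter-1/q≤frac : ∀ X N E K q → 0 < E → 0 < K → 0 < q →
  q * K * N ≤ q * E * X + K * E → frac N E ℚ.* frac 1 4 ℚ.- frac 1 q ℚ.≤ frac X (4 * K)
quarter-1/q≤frac X N E K q 0<E 0<K 0<q h = ≤+⇒-≤ _ _ _ (ℚP.≤-trans
  (ℚP.≤-reflexive (frac-*-frac N E 1 4 0<E (s≤s z≤n)))
  (ℚP.≤-trans (frac-≤ (N * 1) (E * 4) (X * q + 1 * (4 * K)) (4 * K * q) 0<E4 (0<* 0<4K 0<q) cross)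
              (ℚP.≤-reflexive (sym (frac-+-frac X (4 * K) 1 q 0<4K 0<q)))))
  where
  0<E4 : 0 < E * 4
  0<E4 = 0<* 0<E (s≤s z≤n)
  0<4K : 0 < 4 * K
  0<4K = 0<* {4} (s≤s z≤n) 0<K
  cross : N * 1 * (4 * K * q) ≤ (X * q + 1 * (4 * K)) * (E * 4)
  cross = begin
    N * 1 * (4 * K * q)                       ≡⟨ e₁ N K q ⟩
    4 * (q * K * N)                           ≤⟨ *-monoʳ-≤ 4 h ⟩
    4 * (q * E * X + K * E)                   ≤⟨ ≤-reflexive (e₂ q E X K) ⟩
    4 * (q * E * X) + 4 * (K * E)             ≤⟨ +-monoʳ-≤ (4 * (q * E * X)) (m≤m+n (4 * (K * E)) (12 * (K * E))) ⟩
    4 * (q * E * X) + (4 * (K * E) + 12 * (K * E)) ≡⟨ e₃ X q E K ⟩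
    (X * q + 1 * (4 * K)) * (E * 4)           ∎
    where
    open ≤-Reasoning
    e₁ : ∀ N K q → N * 1 * (4 * K * q) ≡ 4 * (q * K * N)
    e₁ = solve-∀
    e₂ : ∀ q E X K → 4 * (q * E * X + K * E) ≡ 4 * (q * E * X) + 4 * (K * E)
    e₂ = solve-∀
    e₃ : ∀ X q E K → 4 * (q * E * X) + (4 * (K * E) + 12 * (K * E)) ≡ (X * q + 1 * (4 * K)) * (E * 4)
    e₃ = solve-∀

1-ε≤fraction : ∀ (ε : ℚ) q total good bad → 0 < q → frac 1 q ℚ.≤ ε → good + bad ≡ total → q * bad ≤ total →
  (1ℚ ℚ.- ε) ℚ.* ℕ→ℚ total ℚ.≤ ℕ→ℚ good
1-ε≤fraction ε q total good bad 0<q 1/q≤ε partition q*bad≤ = begin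
  (1ℚ ℚ.- ε) ℚ.* s     ≤⟨ ℚP.*-monoʳ-≤-nonNeg s (ℚP.+-monoʳ-≤ 1ℚ (ℚP.neg-antimono-≤ 1/q≤ε)) ⟩
  (1ℚ ℚ.- a) ℚ.* s     ≡⟨ trans (ℚP.*-distribʳ-+ s 1ℚ (ℚ.- a)) (cong₂ ℚ._+_ (ℚP.*-identityˡ s) (sym (ℚP.neg-distribˡ-* a s))) ⟩
  s ℚ.- a ℚ.* s        ≤⟨ ≤+⇒-≤ _ _ _ s≤good+as ⟩
  ℕ→ℚ good             ∎
  where
  open ℚP.≤-Reasoning
  s = ℕ→ℚ total
  a = frac 1 q
  instance
    s-nonNeg : ℚ.NonNegative s
    s-nonNeg = ℚ.nonNegative (frac-≤ 0 1 total 1 (s≤s z≤n) (s≤s z≤n) z≤n)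
  q1 : 0 < q * 1
  q1 = 0<* {q} {1} 0<q (s≤s z≤n)
  s≤good+as : s ℚ.≤ ℕ→ℚ good ℚ.+ a ℚ.* s
  s≤good+as = ℚP.≤-trans
    (frac-≤ total 1 (good * (q * 1) + 1 * total * 1) (1 * (q * 1)) (s≤s z≤n) (0<* {1} (s≤s z≤n) q1) cross)
    (ℚP.≤-reflexive (sym (trans (cong (ℕ→ℚ good ℚ.+_) (frac-*-frac 1 q total 1 0<q (s≤s z≤n)))
                                (frac-+-frac good 1 (1 * total) (q * 1) (s≤s z≤n) q1))))
    where
    cross : total * (1 * (q * 1)) ≤ (good * (q * 1) + 1 * total * 1) * 1
    cross = ≤-trans (≤-reflexive (trans (cong (λ z → z * (1 * (q * 1))) (sym partition)) (e₁ good bad q)))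
              (≤-trans (+-monoʳ-≤ (good * q) q*bad≤) (≤-reflexive (e₂ good q total)))
      where
      e₁ : ∀ g b q → (g + b) * (1 * (q * 1)) ≡ g * q + q * b
      e₁ = solve-∀
      e₂ : ∀ g q t → g * q + t ≡ (g * (q * 1) + 1 * t * 1) * 1
      e₂ = solve-∀

multiplicity : {m K : ℕ} → Vec (Fin m × Bool) K → Fin m → ℕ
multiplicity {K = K} H e = sumFin K (λ k → 𝟙 (eqᶠ (proj₁ (lookup H k)) e))

blocksTouching : {n K : ℕ} (G : Graph n) → Vec (Fin (numEdges G) × Bool) K → Subset n → ℕ
blocksTouching {K = K} G H T = sumFin K (λ k → 𝟙 (touches G T (proj₁ (lookup H k))))

blocksTouching≡ : {n K : ℕ} (G : Graph n) (H : Vec (Fin (numEdges G) × Bool) K) (T : Subset n) →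
  blocksTouching G H T ≡ sumFin (numEdges G) (λ e → 𝟙 (touches G T e) * multiplicity H e)
blocksTouching≡ {K = K} G H T = begin
  blocksTouching G H T
    ≡⟨ sumFin-cong K (λ k → sym (sumFin-delta m (proj₁ (lookup H k)) (λ e → 𝟙 (touches G T e)))) ⟩
  sumFin K (λ k → sumFin m (λ e → 𝟙 (eqᶠ (proj₁ (lookup H k)) e) * 𝟙 (touches G T e)))
    ≡⟨ sumFin-swap K m _ ⟩
  sumFin m (λ e → sumFin K (λ k → 𝟙 (eqᶠ (proj₁ (lookup H k)) e) * 𝟙 (touches G T e)))
    ≡⟨ sumFin-cong m (λ e → trans (sumFin-cong K (λ k → *-comm _ (𝟙 (touches G T e)))) (sumFin-*ˡ K (𝟙 (touches G T e)) _)) ⟩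
  sumFin m (λ e → 𝟙 (touches G T e) * multiplicity H e) ∎
  where
  open ≡-Reasoning
  m = numEdges G

∣-∣-view : ∀ a b → (Σ ℕ λ d → (b ≡ a + d) × (∣ a - b ∣ ≡ d)) ⊎ (Σ ℕ λ d → (a ≡ b + d) × (∣ a - b ∣ ≡ d))
∣-∣-view a b with ≤-total a b
... | inj₁ a≤b = inj₁ (b ∸ a , sym (m+[n∸m]≡n a≤b) , trans (∣-∣-comm a b) (m≤n⇒∣n-m∣≡n∸m a≤b))
... | inj₂ b≤a = inj₂ (a ∸ b , sym (m+[n∸m]≡n b≤a) , m≤n⇒∣n-m∣≡n∸m b≤a)

∣-∣²+2ab : ∀ a b → ∣ a - b ∣ * ∣ a - b ∣ + 2 * (a * b) ≡ a * a + b * b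
∣-∣²+2ab a b with ∣-∣-view a b
... | inj₁ (d , refl , e) rewrite e = expand a d
  where
  expand : ∀ a d → d * d + 2 * (a * (a + d)) ≡ a * a + (a + d) * (a + d)
  expand = solve-∀
... | inj₂ (d , refl , e) rewrite e = expand b d
  where
  expand : ∀ b d → d * d + 2 * ((b + d) * b) ≡ (b + d) * (b + d) + b * b
  expand = solve-∀

≤+∣-∣ : ∀ a b → a ≤ b + ∣ a - b ∣
≤+∣-∣ a b with ∣-∣-view a b
... | inj₁ (d , refl , e) rewrite e = ≤-trans (m≤m+n a d) (m≤m+n (a + d) d)
... | inj₂ (d , refl , e) rewrite e = ≤-refl

≤+∣-∣′ : ∀ a b → b ≤ a + ∣ a - b ∣
≤+∣-∣′ a b = subst (λ z → b ≤ a + z) (∣-∣-comm b a) (≤+∣-∣ b a)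

module Concentrated (m N K q : ℕ) (c : Fin m → ℕ) (close : ∀ e → q * ∣ N * c e - K ∣ ≤ K) (t : Fin m → ℕ) where

  weighted-upper : q * N * sumFin m (λ e → t e * c e) ≤ q * K * sumFin m t + K * sumFin m t
  weighted-upper = begin
    q * N * sumFin m (λ e → t e * c e)            ≡⟨ sym (sumFin-*ˡ m (q * N) _) ⟩
    sumFin m (λ e → q * N * (t e * c e))          ≡⟨ sumFin-cong m (λ e → e₁ q N (t e) (c e)) ⟩
    sumFin m (λ e → t e * (q * (N * c e)))        ≤⟨ sumFin-mono m (λ e → *-monoʳ-≤ (t e) (pointwise e)) ⟩
    sumFin m (λ e → t e * (q * K + K))            ≡⟨ sumFin-cong m (λ e → e₂ q K (t e)) ⟩
    sumFin m (λ e → q * K * t e + K * t e)        ≡⟨ sumFin-+ m _ _ ⟩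
    sumFin m (λ e → q * K * t e) + sumFin m (λ e → K * t e) ≡⟨ cong₂ _+_ (sumFin-*ˡ m (q * K) t) (sumFin-*ˡ m K t) ⟩
    q * K * sumFin m t + K * sumFin m t           ∎
    where
    open ≤-Reasoning
    pointwise : ∀ e → q * (N * c e) ≤ q * K + K
    pointwise e = ≤-trans (*-monoʳ-≤ q (≤+∣-∣ (N * c e) K))
                          (≤-trans (≤-reflexive (*-distribˡ-+ q K _)) (+-monoʳ-≤ (q * K) (close e)))
    e₁ : ∀ q N t c → q * N * (t * c) ≡ t * (q * (N * c))
    e₁ = solve-∀
    e₂ : ∀ q K t → t * (q * K + K) ≡ q * K * t + K * t
    e₂ = solve-∀

  weighted-lower : q * K * sumFin m t ≤ q * N * sumFin m (λ e → t e * c e) + K * sumFin m t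
  weighted-lower = begin
    q * K * sumFin m t                            ≡⟨ sym (sumFin-*ˡ m (q * K) t) ⟩
    sumFin m (λ e → q * K * t e)                  ≡⟨ sumFin-cong m (λ e → *-comm (q * K) (t e)) ⟩
    sumFin m (λ e → t e * (q * K))                ≤⟨ sumFin-mono m (λ e → *-monoʳ-≤ (t e) (pointwise e)) ⟩
    sumFin m (λ e → t e * (q * (N * c e) + K))    ≡⟨ sumFin-cong m (λ e → e₁ q N K (t e) (c e)) ⟩
    sumFin m (λ e → q * N * (t e * c e) + K * t e) ≡⟨ sumFin-+ m _ _ ⟩
    sumFin m (λ e → q * N * (t e * c e)) + sumFin m (λ e → K * t e) ≡⟨ cong₂ _+_ (sumFin-*ˡ m (q * N) _) (sumFin-*ˡ m K t) ⟩
    q * N * sumFin m (λ e → t e * c e) + K * sumFin m t ∎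
    where
    open ≤-Reasoning
    pointwise : ∀ e → q * K ≤ q * (N * c e) + K
    pointwise e = ≤-trans (*-monoʳ-≤ q (≤+∣-∣′ (N * c e) K))
                          (≤-trans (≤-reflexive (*-distribˡ-+ q (N * c e) _)) (+-monoʳ-≤ (q * (N * c e)) (close e)))
    e₁ : ∀ q N K t c → t * (q * (N * c) + K) ≡ q * N * (t * c) + K * t
    e₁ = solve-∀

module _ {n K : ℕ} (G : Graph n) (H : Vec (Fin (numEdges G) × Bool) K) (q : ℕ)
  (close : ∀ e → q * ∣ numEdges G * multiplicity H e - K ∣ ≤ K) (T : Subset n) where

  open Concentrated (numEdges G) (numEdges G) K q (multiplicity H) close (λ e → 𝟙 (touches G T e))

  blocksTouching-upper : q * numEdges G * blocksTouching G H T ≤ q * K * numTouching G T + K * numEdges G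
  blocksTouching-upper = subst (λ z → q * numEdges G * z ≤ q * K * numTouching G T + K * numEdges G) (sym (blocksTouching≡ G H T))
    (≤-trans weighted-upper (+-monoʳ-≤ (q * K * numTouching G T) (*-monoʳ-≤ K (numTouching≤numEdges G T))))

  blocksTouching-lower : q * K * numTouching G T ≤ q * numEdges G * blocksTouching G H T + K * numEdges G
  blocksTouching-lower = subst (λ z → q * K * numTouching G T ≤ q * numEdges G * z + K * numEdges G) (sym (blocksTouching≡ G H T))
    (≤-trans weighted-lower (+-monoʳ-≤ _ (*-monoʳ-≤ K (numTouching≤numEdges G T))))

-- Moments of edge multiplicities over all samples

sumL-cartesianProduct : (xs : List A) (ys : List B) (g : A × B → ℕ) →
  sumL (List.cartesianProduct xs ys) g ≡ sumL xs (λ x → sumL ys (λ y → g (x , y)))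
sumL-cartesianProduct []       ys g = refl
sumL-cartesianProduct (x ∷ xs) ys g = trans (sumL-++ (map (x ,_) ys) _ g)
  (cong₂ _+_ (sumL-map (x ,_) ys g) (sumL-cartesianProduct xs ys g))

sumL-affine : (L : List A) (x : ℕ) (c : A → ℕ) → sumL L (λ a → x + c a) ≡ x * sumL L (λ _ → 1) + sumL L c
sumL-affine L x c = trans (sumL-+ L (λ _ → x) c)
  (cong (_+ sumL L c) (trans (sumL-cong L (λ _ → sym (*-identityʳ x))) (sumL-*ˡ L x (λ _ → 1))))

sumL-square : (L : List A) (x : ℕ) (c : A → ℕ) →
  sumL L (λ a → (x + c a) * (x + c a)) ≡ x * x * sumL L (λ _ → 1) + 2 * x * sumL L c + sumL L (λ a → c a * c a)
sumL-square L x c = begin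
  sumL L (λ a → (x + c a) * (x + c a))
    ≡⟨ sumL-cong L (λ a → expand x (c a)) ⟩
  sumL L (λ a → x * x * 1 + 2 * x * c a + c a * c a)
    ≡⟨ trans (sumL-+ L _ _) (cong (_+ sumL L (λ a → c a * c a)) (sumL-+ L _ _)) ⟩
  sumL L (λ _ → x * x * 1) + sumL L (λ a → 2 * x * c a) + sumL L (λ a → c a * c a)
    ≡⟨ cong₂ (λ u v → u + v + sumL L (λ a → c a * c a)) (sumL-*ˡ L (x * x) (λ _ → 1)) (sumL-*ˡ L (2 * x) c) ⟩
  x * x * sumL L (λ _ → 1) + 2 * x * sumL L c + sumL L (λ a → c a * c a) ∎
  where
  open ≡-Reasoning
  expand : ∀ x c → (x + c) * (x + c) ≡ x * x * 1 + 2 * x * c + c * c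
  expand = solve-∀

module Moments (m : ℕ) where

  Draw : Set
  Draw = Fin m × Bool

  draws : List Draw
  draws = List.cartesianProduct (allFin m) (false ∷ true ∷ [])

  samples : (K : ℕ) → List (Vec Draw K)
  samples K = allVecs draws K

  sumSamples-suc : (K : ℕ) (F : Vec Draw (suc K) → ℕ) →
    sumL (samples (suc K)) F ≡ sumL draws (λ a → sumL (samples K) (λ H → F (a ∷ H)))
  sumSamples-suc K F = trans (sumL-concatMap (λ a → map (a ∷_) (samples K)) draws F)
                             (sumL-cong draws (λ a → sumL-map (a ∷_) (samples K) F))

  sumDraws : (g : Draw → ℕ) → sumL draws g ≡ sumL (allFin m) (λ e → g (e , false) + (g (e , true) + 0))
  sumDraws g = sumL-cartesianProduct (allFin m) (false ∷ true ∷ []) g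

  sumDraws-const : (c : ℕ) → sumL draws (λ _ → c) ≡ 2 * m * c
  sumDraws-const c = trans (sumDraws (λ _ → c))
    (trans (sumL-const (allFin m) (c + (c + 0))) (trans (cong ((c + (c + 0)) *_) (length-tabulate id)) (regroup c m)))
    where
    regroup : ∀ c m → (c + (c + 0)) * m ≡ 2 * m * c
    regroup = solve-∀

  sumDraws-edge : (e : Fin m) → sumL draws (λ a → 𝟙 (eqᶠ (proj₁ a) e)) ≡ 2
  sumDraws-edge e = trans (sumDraws _)
    (trans (sumL-*ˡ (allFin m) 2 _) (cong (2 *_) (trans (sumL-tabulate m id _)
      (trans (sumFin-cong m (λ e′ → trans (cong 𝟙 (eqᶠ-sym e′ e)) (sym (*-identityʳ _)))) (sumFin-delta m e (λ _ → 1))))))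

  #samples : ℕ → ℕ
  #samples K = sumL (samples K) (λ _ → 1)

  Σmult : Fin m → ℕ → ℕ
  Σmult e K = sumL (samples K) (λ H → multiplicity H e)

  Σmult² : Fin m → ℕ → ℕ
  Σmult² e K = sumL (samples K) (λ H → multiplicity H e * multiplicity H e)

  #samples-suc : (K : ℕ) → #samples (suc K) ≡ 2 * m * #samples K
  #samples-suc K = trans (sumSamples-suc K _) (sumDraws-const (#samples K))

  #samples≡ : (K : ℕ) → #samples K ≡ (2 * m) ^ K
  #samples≡ zero    = refl
  #samples≡ (suc K) = trans (#samples-suc K) (cong (2 * m *_) (#samples≡ K))

  Σmult-suc : (e : Fin m) (K : ℕ) → Σmult e (suc K) ≡ 2 * #samples K + 2 * m * Σmult e K
  Σmult-suc e K = begin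
    Σmult e (suc K)
      ≡⟨ sumSamples-suc K (λ H → multiplicity H e) ⟩
    sumL draws (λ a → sumL (samples K) (λ H → hit a + multiplicity H e))
      ≡⟨ sumL-cong draws (λ a → sumL-affine (samples K) _ (λ H → multiplicity H e)) ⟩
    sumL draws (λ a → hit a * #samples K + Σmult e K)
      ≡⟨ sumL-+ draws _ _ ⟩
    sumL draws (λ a → hit a * #samples K) + sumL draws (λ _ → Σmult e K)
      ≡⟨ cong₂ _+_ (trans (sumL-cong draws (λ a → *-comm _ (#samples K))) (sumL-*ˡ draws (#samples K) hit)) (sumDraws-const (Σmult e K)) ⟩
    #samples K * sumL draws hit + 2 * m * Σmult e K
      ≡⟨ cong (λ z → #samples K * z + 2 * m * Σmult e K) (sumDraws-edge e) ⟩
    #samples K * 2 + 2 * m * Σmult e K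
      ≡⟨ cong (_+ 2 * m * Σmult e K) (*-comm (#samples K) 2) ⟩
    2 * #samples K + 2 * m * Σmult e K ∎
    where
    open ≡-Reasoning
    hit : Draw → ℕ
    hit a = 𝟙 (eqᶠ (proj₁ a) e)

  Σmult²-suc : (e : Fin m) (K : ℕ) → Σmult² e (suc K) ≡ 2 * #samples K + 4 * Σmult e K + 2 * m * Σmult² e K
  Σmult²-suc e K = begin
    Σmult² e (suc K)
      ≡⟨ sumSamples-suc K _ ⟩
    sumL draws (λ a → sumL (samples K) (λ H → (hit a + multiplicity H e) * (hit a + multiplicity H e)))
      ≡⟨ sumL-cong draws (λ a → sumL-square (samples K) (hit a) (λ H → multiplicity H e)) ⟩
    sumL draws (λ a → hit a * hit a * #samples K + 2 * hit a * Σmult e K + Σmult² e K)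
      ≡⟨ sumL-cong draws (λ a → trans (cong (λ z → z * #samples K + 2 * hit a * Σmult e K + Σmult² e K) (𝟙-idem (eqᶠ (proj₁ a) e)))
                                      (collect (hit a) (#samples K) (Σmult e K) (Σmult² e K))) ⟩
    sumL draws (λ a → (#samples K + 2 * Σmult e K) * hit a + Σmult² e K)
      ≡⟨ trans (sumL-+ draws _ _) (cong₂ _+_ (sumL-*ˡ draws (#samples K + 2 * Σmult e K) hit) (sumDraws-const (Σmult² e K))) ⟩
    (#samples K + 2 * Σmult e K) * sumL draws hit + 2 * m * Σmult² e K
      ≡⟨ cong (λ z → (#samples K + 2 * Σmult e K) * z + 2 * m * Σmult² e K) (sumDraws-edge e) ⟩
    (#samples K + 2 * Σmult e K) * 2 + 2 * m * Σmult² e K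
      ≡⟨ distribute (#samples K) (Σmult e K) (2 * m * Σmult² e K) ⟩
    2 * #samples K + 4 * Σmult e K + 2 * m * Σmult² e K ∎
    where
    open ≡-Reasoning
    hit : Draw → ℕ
    hit a = 𝟙 (eqᶠ (proj₁ a) e)
    collect : ∀ i s₀ s₁ s₂ → i * s₀ + 2 * i * s₁ + s₂ ≡ (s₀ + 2 * s₁) * i + s₂
    collect = solve-∀
    distribute : ∀ s₀ s₁ z → (s₀ + 2 * s₁) * 2 + z ≡ 2 * s₀ + 4 * s₁ + z
    distribute = solve-∀

  first-moment : (e : Fin m) (K : ℕ) → m * Σmult e K ≡ K * #samples K
  first-moment e zero    = *-zeroʳ m
  first-moment e (suc K) = begin
    m * Σmult e (suc K)                             ≡⟨ cong (m *_) (Σmult-suc e K) ⟩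
    m * (2 * #samples K + 2 * m * Σmult e K)        ≡⟨ e₁ m (#samples K) (Σmult e K) ⟩
    2 * m * #samples K + 2 * m * (m * Σmult e K)    ≡⟨ cong (λ z → 2 * m * #samples K + 2 * m * z) (first-moment e K) ⟩
    2 * m * #samples K + 2 * m * (K * #samples K)   ≡⟨ e₂ m K (#samples K) ⟩
    suc K * (2 * m * #samples K)                    ≡⟨ cong (suc K *_) (sym (#samples-suc K)) ⟩
    suc K * #samples (suc K)                        ∎
    where
    open ≡-Reasoning
    e₁ : ∀ m s₀ s₁ → m * (2 * s₀ + 2 * m * s₁) ≡ 2 * m * s₀ + 2 * m * (m * s₁)
    e₁ = solve-∀
    e₂ : ∀ m K s₀ → 2 * m * s₀ + 2 * m * (K * s₀) ≡ suc K * (2 * m * s₀)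
    e₂ = solve-∀

  second-moment : (e : Fin m) (K : ℕ) → m * m * Σmult² e K + K * #samples K ≡ (m * K + K * K) * #samples K
  second-moment e zero    = e₀ m
    where
    e₀ : ∀ m → m * m * 0 + 0 ≡ (m * 0 + 0) * 1
    e₀ = solve-∀
  second-moment e (suc K) = begin
    m * m * Σmult² e (suc K) + suc K * #samples (suc K)
      ≡⟨ cong₂ (λ u v → m * m * u + suc K * v) (Σmult²-suc e K) (#samples-suc K) ⟩
    m * m * (2 * #samples K + 4 * Σmult e K + 2 * m * Σmult² e K) + suc K * (2 * m * #samples K)
      ≡⟨ e₁ m K (#samples K) (Σmult e K) (Σmult² e K) ⟩
    2 * m * m * #samples K + 4 * m * (m * Σmult e K) + 2 * m * (m * m * Σmult² e K + K * #samples K) + 2 * m * #samples K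
      ≡⟨ cong₂ (λ u v → 2 * m * m * #samples K + 4 * m * u + 2 * m * v + 2 * m * #samples K) (first-moment e K) (second-moment e K) ⟩
    2 * m * m * #samples K + 4 * m * (K * #samples K) + 2 * m * ((m * K + K * K) * #samples K) + 2 * m * #samples K
      ≡⟨ e₂ m K (#samples K) ⟩
    (m * suc K + suc K * suc K) * (2 * m * #samples K)
      ≡⟨ cong ((m * suc K + suc K * suc K) *_) (sym (#samples-suc K)) ⟩
    (m * suc K + suc K * suc K) * #samples (suc K) ∎
    where
    open ≡-Reasoning
    e₁ : ∀ m K s₀ s₁ s₂ → m * m * (2 * s₀ + 4 * s₁ + 2 * m * s₂) + suc K * (2 * m * s₀) ≡
         2 * m * m * s₀ + 4 * m * (m * s₁) + 2 * m * (m * m * s₂ + K * s₀) + 2 * m * s₀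
    e₁ = solve-∀
    e₂ : ∀ m K s₀ → 2 * m * m * s₀ + 4 * m * (K * s₀) + 2 * m * ((m * K + K * K) * s₀) + 2 * m * s₀ ≡
         (m * suc K + suc K * suc K) * (2 * m * s₀)
    e₂ = solve-∀

  module _ (K q : ℕ) where

    deviation : Fin m → Vec Draw K → ℕ
    deviation e H = ∣ m * multiplicity H e - K ∣

    Σdeviation² : (e : Fin m) → sumL (samples K) (λ H → deviation e H * deviation e H) + K * #samples K ≡ m * K * #samples K
    Σdeviation² e = +-cancelʳ-≡ (2 * K * K * #samples K) _ _ (begin
      X + K * #samples K + 2 * K * K * #samples K
        ≡⟨ cong (λ z → X + K * #samples K + z) (trans (*-assoc (2 * K) K (#samples K)) (cong (2 * K *_) (sym (first-moment e K)))) ⟩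
      X + K * #samples K + 2 * K * (m * Σmult e K)   ≡⟨ e₁ X (K * #samples K) K m (Σmult e K) ⟩
      (X + 2 * m * K * Σmult e K) + K * #samples K   ≡⟨ cong (_+ K * #samples K) expand ⟩
      m * m * Σmult² e K + K * K * #samples K + K * #samples K ≡⟨ e₂ (m * m * Σmult² e K) (K * K * #samples K) (K * #samples K) ⟩
      (m * m * Σmult² e K + K * #samples K) + K * K * #samples K ≡⟨ cong (_+ K * K * #samples K) (second-moment e K) ⟩
      (m * K + K * K) * #samples K + K * K * #samples K ≡⟨ e₃ m K (#samples K) ⟩
      m * K * #samples K + 2 * K * K * #samples K ∎)
      where
      open ≡-Reasoning
      X = sumL (samples K) (λ H → deviation e H * deviation e H)
      e₁ : ∀ X a K m s → X + a + 2 * K * (m * s) ≡ (X + 2 * m * K * s) + a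
      e₁ = solve-∀
      e₂ : ∀ a b c → a + b + c ≡ (a + c) + b
      e₂ = solve-∀
      e₃ : ∀ m K s → (m * K + K * K) * s + K * K * s ≡ m * K * s + 2 * K * K * s
      e₃ = solve-∀
      e₄ : ∀ m K c → 2 * m * K * c ≡ 2 * (m * c * K)
      e₄ = solve-∀
      e₅ : ∀ m K c → m * c * (m * c) + K * K ≡ m * m * (c * c) + K * K * 1
      e₅ = solve-∀
      square : ∀ H → deviation e H * deviation e H + 2 * m * K * multiplicity H e ≡ m * m * (multiplicity H e * multiplicity H e) + K * K * 1
      square H = trans (cong (deviation e H * deviation e H +_) (e₄ m K (multiplicity H e)))
                       (trans (∣-∣²+2ab (m * multiplicity H e) K) (e₅ m K (multiplicity H e)))
      expand : X + 2 * m * K * Σmult e K ≡ m * m * Σmult² e K + K * K * #samples K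
      expand = begin
        X + 2 * m * K * Σmult e K
          ≡⟨ cong (X +_) (sym (sumL-*ˡ (samples K) (2 * m * K) (λ H → multiplicity H e))) ⟩
        X + sumL (samples K) (λ H → 2 * m * K * multiplicity H e)
          ≡⟨ trans (sym (sumL-+ (samples K) _ _)) (sumL-cong (samples K) square) ⟩
        sumL (samples K) (λ H → m * m * (multiplicity H e * multiplicity H e) + K * K * 1)
          ≡⟨ trans (sumL-+ (samples K) _ _) (cong₂ _+_ (sumL-*ˡ (samples K) (m * m) _) (sumL-*ˡ (samples K) (K * K) _)) ⟩
        m * m * Σmult² e K + K * K * #samples K ∎

    close? : (H : Vec Draw K) (e : Fin m) → Dec (q * deviation e H ≤ K)
    close? H e = q * deviation e H ≤? K

    Concentrated? : (H : Vec Draw K) → Dec (∀ e → q * deviation e H ≤ K)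
    Concentrated? H = all? (close? H)

    #far : Fin m → ℕ
    #far e = sumL (samples K) (λ H → 𝟙 (not (does (close? H e))))

    chebyshev : (e : Fin m) → 0 < K → #far e * K ≤ q * q * m * #samples K
    chebyshev e 0<K = *-cancelʳ-≤ (#far e * K) (q * q * m * #samples K) K {{ℕ.>-nonZero 0<K}} (begin
      #far e * K * K                                        ≡⟨ trans (*-assoc (#far e) K K) (*-comm (#far e) (K * K)) ⟩
      K * K * #far e                                        ≡⟨ sym (sumL-*ˡ (samples K) (K * K) _) ⟩
      sumL (samples K) (λ H → K * K * 𝟙 (not (does (close? H e)))) ≤⟨ sumL-mono (samples K) pointwise ⟩
      sumL (samples K) (λ H → q * q * (deviation e H * deviation e H)) ≡⟨ sumL-*ˡ (samples K) (q * q) _ ⟩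
      q * q * sumL (samples K) (λ H → deviation e H * deviation e H) ≤⟨ *-monoʳ-≤ (q * q) (m+n≤o⇒m≤o _ (≤-reflexive (Σdeviation² e))) ⟩
      q * q * (m * K * #samples K)                          ≡⟨ e₁ q m K (#samples K) ⟩
      q * q * m * #samples K * K                            ∎)
      where
      open ≤-Reasoning
      e₁ : ∀ q m K s → q * q * (m * K * s) ≡ q * q * m * s * K
      e₁ = solve-∀
      e₂ : ∀ q d → q * d * (q * d) ≡ q * q * (d * d)
      e₂ = solve-∀
      pointwise : ∀ H → K * K * 𝟙 (not (does (close? H e))) ≤ q * q * (deviation e H * deviation e H)
      pointwise H = scaled-𝟙-rejected≤ (close? H e) (λ ¬close →
        let K≤ = <⇒≤ (≰⇒> ¬close) in subst (K * K ≤_) (e₂ q (deviation e H)) (*-mono-≤ K≤ K≤))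

    #rejected : ℕ
    #rejected = sumL (samples K) (λ H → 𝟙 (not (does (Concentrated? H))))

    rejected-union-bound : #rejected ≤ sumFin m #far
    rejected-union-bound = begin
      #rejected                                                         ≤⟨ sumL-mono (samples K) (λ H → 𝟙-rejected-all≤ m (close? H)) ⟩
      sumL (samples K) (λ H → sumFin m (λ e → 𝟙 (not (does (close? H e))))) ≡⟨ sumL-sumFin (samples K) m _ ⟩
      sumFin m #far                                                     ∎
      where open ≤-Reasoning

    rejected-bound : 0 < K → 0 < m → 0 < q → q * q * q * (m * m) ≤ K → q * #rejected ≤ #samples K
    rejected-bound 0<K 0<m 0<q q³m²≤K = *-cancelʳ-≤ (q * #rejected) (#samples K) (q * q * (m * m)) {{nonZero}} (begin
      q * #rejected * (q * q * (m * m))        ≡⟨ e₁ q #rejected m ⟩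
      #rejected * (q * q * q * (m * m))        ≤⟨ *-monoʳ-≤ #rejected q³m²≤K ⟩
      #rejected * K                            ≤⟨ *-monoˡ-≤ K rejected-union-bound ⟩
      sumFin m #far * K                        ≡⟨ sumFin-*ʳ m #far K ⟩
      sumFin m (λ e → #far e * K)              ≤⟨ sumFin-mono m (λ e → chebyshev e 0<K) ⟩
      sumFin m (λ _ → q * q * m * #samples K)  ≡⟨ sumFin-const m _ ⟩
      m * (q * q * m * #samples K)             ≡⟨ e₂ q m (#samples K) ⟩
      #samples K * (q * q * (m * m))           ∎)
      where
      open ≤-Reasoning
      e₁ : ∀ q N m → q * N * (q * q * (m * m)) ≡ N * (q * q * q * (m * m))
      e₁ = solve-∀
      e₂ : ∀ q m s → m * (q * q * m * s) ≡ s * (q * q * (m * m))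
      e₂ = solve-∀
      nonZero : ℕ.NonZero (q * q * (m * m))
      nonZero = ℕ.>-nonZero (0<* (0<* 0<q 0<q) (0<* 0<m 0<m))

    concentratedSamples : List (Vec Draw K)
    concentratedSamples = List.filter Concentrated? (samples K)

    length-concentrated+rejected : length concentratedSamples + #rejected ≡ #samples K
    length-concentrated+rejected = length-filter+rejected Concentrated? (samples K)

-- The function f for a fixed sample

bool-cases : (b : Bool) {P : Set} → (b ≡ true → P) → (b ≡ false → P) → P
bool-cases true  t u = t refl
bool-cases false t u = u refl

∧-true-left : ∀ {a b} → (a ∧ b) ≡ true → a ≡ true
∧-true-left {true} _ = refl

∧-true-right : ∀ {a b} → (a ∧ b) ≡ true → b ≡ true
∧-true-right {true} e = e

quadruple : ∀ X → X + X + (X + X) ≡ 4 * X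
quadruple = solve-∀

+-double-cancel-≤ : ∀ a b → a + a ≤ b + b → a ≤ b
+-double-cancel-≤ a b h = *-cancelˡ-≤ 2 (subst₂ _≤_ (cong (a +_) (sym (+-identityʳ a))) (cong (b +_) (sym (+-identityʳ b))) h)

module FixedSample {n : ℕ} (M : Subset n) (σ : Fin (n / 2) → Fin n) (A : Subset n) (G : Graph n) (H : Sample n G)
  (σ∈M : ∀ k → lookup M (σ k) ≡ true) (G-on : IsGraphOn (∁ M) G) (k₀ : Fin (n / 2))
  (2^m≡2K : 2 ^ (n / 2) ≡ 2 * half n) (low≡top-clear : ∀ x → (Γ₀ σ x <ᵇ half n) ≡ not (lookup x (σ k₀))) where

  K : ℕ
  K = half n

  Γ : Input n → ℕ
  Γ = Γ₀ σ

  f : Input n → Bool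
  f = fMAH M σ A G H

  low : Input n → Bool
  low x = Γ x <ᵇ K

  top : Fin n
  top = σ k₀

  f-low : ∀ x → low x ≡ true → f x ≡ parityOn M x
  f-low x e = cong (λ b → if b then parityOn M x else hHigh G H (Γ x ∸ K) x) e

  f-high : ∀ x → low x ≡ false → f x ≡ hHigh G H (Γ x ∸ K) x
  f-high x e = cong (λ b → if b then parityOn M x else hHigh G H (Γ x ∸ K) x) e

  blockEdge : ℕ → Fin n × Fin n
  blockEdge j with j <? half n
  ... | yes j<K = edge G (proj₁ (lookup H (fromℕ< j<K)))
  ... | no  _   = (top , top)

  blockBit : ℕ → Bool
  blockBit j with j <? half n
  ... | yes j<K = proj₂ (lookup H (fromℕ< j<K))
  ... | no  _   = false

  hHigh-form : ∀ j x → hHigh G H j x ≡ (lookup x (proj₁ (blockEdge j)) xor lookup x (proj₂ (blockEdge j)) xor blockBit j)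
  hHigh-form j x with j <? half n
  ... | yes _ = refl
  ... | no  _ = sym (trans (cong (lookup x top xor_) (xor-identityʳ (lookup x top))) (xor-same (lookup x top)))

  blockEdge-valid : ∀ j → j < K → IsEdge G (blockEdge j)
  blockEdge-valid j j<K with j <? half n
  ... | yes _   = edge-valid G _
  ... | no  j≮K = ⊥-elim (j≮K j<K)

  blockEdge-outside : ∀ j → j < K → EdgeOutside M (blockEdge j)
  blockEdge-outside j j<K = edge-outside M G G-on (blockEdge j) (blockEdge-valid j j<K)

  blockEdge-ends-distinct : ∀ j → j < K → proj₁ (blockEdge j) ≢ proj₂ (blockEdge j)
  blockEdge-ends-distinct j j<K e = <-irrefl (cong toℕ e) (proj₂ (blockEdge-valid j j<K))

  ∉M⇒≢σ : ∀ i k → lookup M i ≡ false → i ≢ σ k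
  ∉M⇒≢σ i k Mi refl = true≢false (trans (sym (σ∈M k)) Mi)

  Γ-flipAt-∉ : ∀ i → lookup M i ≡ false → ∀ x → Γ (flipAt i x) ≡ Γ x
  Γ-flipAt-∉ i Mi x = val-cong (n / 2) (λ k → flipAt-other i (σ k) x (∉M⇒≢σ i k Mi))

  Γ-cong : ∀ x y → (∀ i → lookup M i ≡ true → lookup x i ≡ lookup y i) → Γ x ≡ Γ y
  Γ-cong x y h = val-cong (n / 2) (λ k → h (σ k) (σ∈M k))

  high-index< : ∀ x → low x ≡ false → Γ x ∸ K < K
  high-index< x e = +-cancelˡ-< K (Γ x ∸ K) K
    (subst (_< K + K) (sym (m+[n∸m]≡n K≤Γ))
           (subst (Γ x <_) (trans 2^m≡2K (cong (K +_) (+-identityʳ K))) (val-bound (n / 2) (λ k → lookup x (σ k)))))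
    where
    K≤Γ : K ≤ Γ x
    K≤Γ = ≮⇒≥ (λ lt → true≢false (trans (sym (<⇒<ᵇ≡true lt)) e))

  hHigh-flip₁ : ∀ j x → j < K → hHigh G H j (flipAt (proj₁ (blockEdge j)) x) ≡ not (hHigh G H j x)
  hHigh-flip₁ j x j<K = begin
    hHigh G H j (flipAt a x)                                  ≡⟨ hHigh-form j (flipAt a x) ⟩
    lookup (flipAt a x) a xor lookup (flipAt a x) b xor blockBit j
      ≡⟨ cong₂ (λ u v → u xor v xor blockBit j) (flipAt-same a x) (flipAt-other a b x (blockEdge-ends-distinct j j<K)) ⟩
    not (lookup x a) xor lookup x b xor blockBit j
      ≡⟨ sym (not-distribˡ-xor (lookup x a) _) ⟩
    not (lookup x a xor lookup x b xor blockBit j)            ≡⟨ cong not (sym (hHigh-form j x)) ⟩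
    not (hHigh G H j x) ∎
    where
    open ≡-Reasoning
    a = proj₁ (blockEdge j)
    b = proj₂ (blockEdge j)

  hHigh-flip₂ : ∀ j x → j < K → hHigh G H j (flipAt (proj₂ (blockEdge j)) x) ≡ not (hHigh G H j x)
  hHigh-flip₂ j x j<K = begin
    hHigh G H j (flipAt b x)                                  ≡⟨ hHigh-form j (flipAt b x) ⟩
    lookup (flipAt b x) a xor lookup (flipAt b x) b xor blockBit j
      ≡⟨ cong₂ (λ u v → u xor v xor blockBit j) (flipAt-other b a x (λ e → blockEdge-ends-distinct j j<K (sym e))) (flipAt-same b x) ⟩
    lookup x a xor not (lookup x b) xor blockBit j
      ≡⟨ trans (cong (lookup x a xor_) (sym (not-distribˡ-xor (lookup x b) _))) (sym (not-distribʳ-xor (lookup x a) _)) ⟩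
    not (lookup x a xor lookup x b xor blockBit j)            ≡⟨ cong not (sym (hHigh-form j x)) ⟩
    not (hHigh G H j x) ∎
    where
    open ≡-Reasoning
    a = proj₁ (blockEdge j)
    b = proj₂ (blockEdge j)

  hHigh-cong : ∀ j x y → lookup x (proj₁ (blockEdge j)) ≡ lookup y (proj₁ (blockEdge j)) →
    lookup x (proj₂ (blockEdge j)) ≡ lookup y (proj₂ (blockEdge j)) → hHigh G H j x ≡ hHigh G H j y
  hHigh-cong j x y e₁ e₂ =
    trans (hHigh-form j x) (trans (cong₂ (λ u v → u xor v xor blockBit j) e₁ e₂) (sym (hHigh-form j y)))

  count-low-double : count n low + count n low ≡ 2 ^ n
  count-low-double = trans (cong₂ _+_ e e) (count-coord-false n top)
    where e = count-cong n low≡top-clear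

  count-high≡count-low : count n (λ x → not (low x)) ≡ count n low
  count-high≡count-low = +-cancelˡ-≡ (count n low) _ _
    (trans (sym (count-split n (λ _ → true) low)) (trans (count-true n) (sym count-low-double)))

  0<K : 0 < K
  0<K = n≢0⇒n>0 (λ K≡0 → <-irrefl refl (subst (0 <_) (trans 2^m≡2K (cong (2 *_) K≡0)) (m^n>0 2 (n / 2))))

  errors : (Input n → Bool) → ℕ
  errors g = count n (λ x → f x xor g x)

  module Cut (T : Subset n) where

    touchesBlock : ℕ → Bool
    touchesBlock j = lookup T (proj₁ (blockEdge j)) ∨ lookup T (proj₂ (blockEdge j))

    hitsValue : ℕ → Bool
    hitsValue γ = not (γ <ᵇ K) ∧ touchesBlock (γ ∸ K)

    hits : Input n → Bool
    hits x = hitsValue (Γ x)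

    endpointIn : ℕ → Fin n
    endpointIn j = if lookup T (proj₁ (blockEdge j)) then proj₁ (blockEdge j) else proj₂ (blockEdge j)

    switch : Input n → Input n
    switch x = if hits x then flipAt (endpointIn (Γ x ∸ K)) x else x

    endpointIn-∉M : ∀ j → j < K → lookup M (endpointIn j) ≡ false
    endpointIn-∉M j j<K with lookup T (proj₁ (blockEdge j))
    ... | true  = proj₁ (blockEdge-outside j j<K)
    ... | false = proj₂ (blockEdge-outside j j<K)

    endpointIn-∈T : ∀ j → touchesBlock j ≡ true → lookup T (endpointIn j) ≡ true
    endpointIn-∈T j e with lookup T (proj₁ (blockEdge j)) in e₁
    ... | true  = e₁
    ... | false = e

    hHigh-flip-endpointIn : ∀ j x → j < K → hHigh G H j (flipAt (endpointIn j) x) ≡ not (hHigh G H j x)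
    hHigh-flip-endpointIn j x j<K with lookup T (proj₁ (blockEdge j))
    ... | true  = hHigh-flip₁ j x j<K
    ... | false = hHigh-flip₂ j x j<K

    hits⇒high : ∀ x → hits x ≡ true → low x ≡ false
    hits⇒high x e with low x
    ... | false = refl
    ... | true  = ⊥-elim (true≢false (sym e))

    hits⇒touches : ∀ x → hits x ≡ true → touchesBlock (Γ x ∸ K) ≡ true
    hits⇒touches x e with low x
    ... | false = e
    ... | true  = ⊥-elim (true≢false (sym e))

    hits⇒index< : ∀ x → hits x ≡ true → Γ x ∸ K < K
    hits⇒index< x e = high-index< x (hits⇒high x e)

    switch-hit : ∀ x → hits x ≡ true → switch x ≡ flipAt (endpointIn (Γ x ∸ K)) x
    switch-hit x e = cong (λ b → if b then flipAt (endpointIn (Γ x ∸ K)) x else x) e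

    switch-miss : ∀ x → hits x ≡ false → switch x ≡ x
    switch-miss x e = cong (λ b → if b then flipAt (endpointIn (Γ x ∸ K)) x else x) e

    Γ-switch : ∀ x → Γ (switch x) ≡ Γ x
    Γ-switch x = bool-cases (hits x)
      (λ e → trans (cong Γ (switch-hit x e)) (Γ-flipAt-∉ _ (endpointIn-∉M _ (hits⇒index< x e)) x))
      (λ e → cong Γ (switch-miss x e))

    hits-switch : ∀ x → hits (switch x) ≡ hits x
    hits-switch x = cong hitsValue (Γ-switch x)

    switch-involutive : ∀ x → switch (switch x) ≡ x
    switch-involutive x = bool-cases (hits x)
      (λ e → trans (switch-hit (switch x) (trans (hits-switch x) e))
                   (trans (cong₂ (λ γ y → flipAt (endpointIn (γ ∸ K)) y) (Γ-switch x) (switch-hit x e)) (flipAt-involutive _ x)))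
      (λ e → trans (cong switch (switch-miss x e)) (switch-miss x e))

    f-switch : ∀ x → hits x ≡ true → f (switch x) ≡ not (f x)
    f-switch x e = begin
      f (switch x)                             ≡⟨ f-high (switch x) (trans (cong (_<ᵇ K) (Γ-switch x)) (hits⇒high x e)) ⟩
      hHigh G H (Γ (switch x) ∸ K) (switch x)  ≡⟨ cong₂ (λ γ y → hHigh G H (γ ∸ K) y) (Γ-switch x) (switch-hit x e) ⟩
      hHigh G H (Γ x ∸ K) (flipAt (endpointIn (Γ x ∸ K)) x) ≡⟨ hHigh-flip-endpointIn _ x (hits⇒index< x e) ⟩
      not (hHigh G H (Γ x ∸ K) x)              ≡⟨ cong not (sym (f-high x (hits⇒high x e))) ⟩
      not (f x) ∎
      where open ≡-Reasoning

    hitCount : ℕ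
    hitCount = count n hits

    cutJunta : Input n → Bool
    cutJunta x = if hits x then false else f x

    disagree-on-hits-half : (g : Input n → Bool) → (∀ i x → lookup T i ≡ true → g (flipAt i x) ≡ g x) →
      count n (λ x → hits x ∧ (f x xor g x)) + count n (λ x → hits x ∧ (f x xor g x)) ≡ hitCount
    disagree-on-hits-half g g-inv = count-disagree-half n switch switch-involutive hits f g hits-switch f-switch
      (λ x e → trans (cong g (switch-hit x e)) (g-inv _ x (endpointIn-∈T _ (hits⇒touches x e))))

    errors-cutJunta : errors cutJunta + errors cutJunta ≡ hitCount
    errors-cutJunta = trans (cong₂ _+_ (count-cong n on-hits) (count-cong n on-hits))
                            (disagree-on-hits-half (λ _ → false) (λ _ _ _ → refl))
      where
      on-hits : ∀ x → (f x xor cutJunta x) ≡ (hits x ∧ (f x xor false))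
      on-hits x with hits x
      ... | true  = refl
      ... | false = xor-same (f x)

    hitCount≤errors : (g : Input n → Bool) → (∀ i x → lookup T i ≡ true → g (flipAt i x) ≡ g x) →
      hitCount ≤ errors g + errors g
    hitCount≤errors g g-inv = subst (_≤ _) (disagree-on-hits-half g g-inv) (+-mono-≤ on-hits≤ on-hits≤)
      where
      on-hits≤ : count n (λ x → hits x ∧ (f x xor g x)) ≤ errors g
      on-hits≤ = count-mono n (λ x e → ∧-true-right {hits x} e)

    hitCount≤count-high : hitCount ≤ count n (λ x → not (low x))
    hitCount≤count-high = count-mono n (λ x e → ∧-true-left {not (low x)} e)

    cutJunta-ignores-T : (∀ i → lookup T i ≡ true → lookup M i ≡ false) →
      ∀ x y → (∀ i → lookup (∁ T) i ≡ true → lookup x i ≡ lookup y i) → cutJunta x ≡ cutJunta y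
    cutJunta-ignores-T T∩M=∅ x y agree = bool-cases (hits x)
      (λ e → trans (cong (λ b → if b then false else f x) e) (sym (cong (λ b → if b then false else f y) (trans (sym same-hits) e))))
      (λ e → trans (cong (λ b → if b then false else f x) e)
                   (trans (f-agree e) (sym (cong (λ b → if b then false else f y) (trans (sym same-hits) e)))))
      where
      agree-outside : ∀ i → lookup T i ≡ false → lookup x i ≡ lookup y i
      agree-outside i e = agree i (trans (lookup-∁ T i) (cong not e))
      agree-on-M : ∀ i → lookup M i ≡ true → lookup x i ≡ lookup y i
      agree-on-M i Mi = agree-outside i (bool-cases (lookup T i) (λ Ti → ⊥-elim (true≢false (trans (sym Mi) (T∩M=∅ i Ti)))) id)
      same-Γ : Γ x ≡ Γ y
      same-Γ = Γ-cong x y agree-on-M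
      same-hits : hits x ≡ hits y
      same-hits = cong hitsValue same-Γ
      same-low : low x ≡ low y
      same-low = cong (_<ᵇ K) same-Γ
      f-agree : hits x ≡ false → f x ≡ f y
      f-agree miss = bool-cases (low x)
        (λ e → trans (f-low x e) (trans (parityOn-cong M x y agree-on-M) (sym (f-low y (trans (sym same-low) e)))))
        (λ e → trans (f-high x e)
          (trans (hHigh-cong _ x y (agree-outside _ (∨-conicalˡ _ _ (untouched e))) (agree-outside _ (∨-conicalʳ _ _ (untouched e))))
          (trans (cong (λ γ → hHigh G H (γ ∸ K) y) same-Γ) (sym (f-high y (trans (sym same-low) e))))))
        where
        untouched : low x ≡ false → touchesBlock (Γ x ∸ K) ≡ false
        untouched e = trans (sym (cong (λ b → not b ∧ touchesBlock (Γ x ∸ K)) e)) miss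

  quarter≤ : ∀ X Y → X + X ≡ Y → Y + Y ≡ 2 ^ n → 2 ^ n ≤ 4 * X
  quarter≤ X Y X+X≡Y Y+Y≡2^n = ≤-reflexive (trans (sym Y+Y≡2^n) (trans (cong₂ _+_ (sym X+X≡Y) (sym X+X≡Y)) (quadruple X)))

  errors≥quarter-if-ignores-∈M : (g : Input n → Bool) (i : Fin n) → lookup M i ≡ true → i ≢ top →
    (∀ x → g (flipAt i x) ≡ g x) → 2 ^ n ≤ 4 * errors g
  errors≥quarter-if-ignores-∈M g i Mi i≢top g-inv =
    ≤-trans (quarter≤ (count n (λ x → low x ∧ (f x xor g x))) (count n low) halves count-low-double)
            (*-monoʳ-≤ 4 (count-mono n (λ x e → ∧-true-right {low x} e)))
    where
    low-flip : ∀ x → low (flipAt i x) ≡ low x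
    low-flip x = trans (low≡top-clear (flipAt i x)) (trans (cong not (flipAt-other i top x i≢top)) (sym (low≡top-clear x)))
    halves : count n (λ x → low x ∧ (f x xor g x)) + count n (λ x → low x ∧ (f x xor g x)) ≡ count n low
    halves = count-disagree-half n (flipAt i) (flipAt-involutive i) low f g low-flip
      (λ x e → trans (f-low _ (trans (low-flip x) e)) (trans (parityOn-flipAt-∈ M i Mi x) (cong not (sym (f-low x e)))))
      (λ x _ → g-inv x)

  disagree-triangle : ∀ a b c l → 𝟙 (l ∧ (b xor a)) ≤ 𝟙 ((a xor c) ∧ l) + 𝟙 ((b xor c) ∧ l)
  disagree-triangle a b c false = z≤n
  disagree-triangle true  true  c     true = z≤n
  disagree-triangle false false c     true = z≤n
  disagree-triangle true  false true  true = s≤s z≤n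
  disagree-triangle true  false false true = s≤s z≤n
  disagree-triangle false true  true  true = s≤s z≤n
  disagree-triangle false true  false true = s≤s z≤n

  -- On low inputs, flipping the endpoint a x (outside M) of the edge of the high block of flipAt top x
  -- fixes f but negates F x = f (flipAt top x); so f and F disagree on half of the low inputs.
  module TopPairing where

    low-flip-top : ∀ x → low (flipAt top x) ≡ not (low x)
    low-flip-top x = trans (low≡top-clear (flipAt top x)) (trans (cong not (flipAt-same top x)) (cong not (sym (low≡top-clear x))))

    a : Input n → Fin n
    a x = proj₁ (blockEdge (Γ (flipAt top x) ∸ K))

    index< : ∀ x → low x ≡ true → Γ (flipAt top x) ∸ K < K
    index< x e = high-index< (flipAt top x) (trans (low-flip-top x) (cong not e))

    a∉M : ∀ x → low x ≡ true → lookup M (a x) ≡ false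
    a∉M x e = proj₁ (blockEdge-outside _ (index< x e))

    ψ : Input n → Input n
    ψ x = if low x then flipAt (a x) x else x

    ψ-low : ∀ x → low x ≡ true → ψ x ≡ flipAt (a x) x
    ψ-low x e = cong (λ b → if b then flipAt (a x) x else x) e

    ψ-high : ∀ x → low x ≡ false → ψ x ≡ x
    ψ-high x e = cong (λ b → if b then flipAt (a x) x else x) e

    a-ψ : ∀ x → low x ≡ true → a (flipAt (a x) x) ≡ a x
    a-ψ x e = cong (λ γ → proj₁ (blockEdge (γ ∸ K)))
      (trans (cong Γ (flipAt-comm top (a x) x)) (Γ-flipAt-∉ (a x) (a∉M x e) (flipAt top x)))

    low-ψ : ∀ x → low (ψ x) ≡ low x
    low-ψ x = bool-cases (low x)
      (λ e → trans (cong low (ψ-low x e)) (cong (_<ᵇ K) (Γ-flipAt-∉ (a x) (a∉M x e) x)))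
      (λ e → cong low (ψ-high x e))

    ψ-involutive : ∀ x → ψ (ψ x) ≡ x
    ψ-involutive x = bool-cases (low x)
      (λ e → trans (ψ-low (ψ x) (trans (low-ψ x) e))
                   (trans (cong (λ y → flipAt (a y) y) (ψ-low x e))
                          (trans (cong (λ i → flipAt i (flipAt (a x) x)) (a-ψ x e)) (flipAt-involutive (a x) x))))
      (λ e → trans (cong ψ (ψ-high x e)) (ψ-high x e))

    F : Input n → Bool
    F x = f (flipAt top x)

    F-ψ : ∀ x → low x ≡ true → F (ψ x) ≡ not (F x)
    F-ψ x e = begin
      f (flipAt top (ψ x))                        ≡⟨ cong (λ y → f (flipAt top y)) (ψ-low x e) ⟩
      f (flipAt top (flipAt (a x) x))             ≡⟨ cong f (flipAt-comm top (a x) x) ⟩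
      f (flipAt (a x) y)                          ≡⟨ f-high (flipAt (a x) y) (trans (cong (_<ᵇ K) Γ-same) y-high) ⟩
      hHigh G H (Γ (flipAt (a x) y) ∸ K) (flipAt (a x) y) ≡⟨ cong (λ γ → hHigh G H (γ ∸ K) (flipAt (a x) y)) Γ-same ⟩
      hHigh G H (Γ y ∸ K) (flipAt (a x) y)        ≡⟨ hHigh-flip₁ (Γ y ∸ K) y (index< x e) ⟩
      not (hHigh G H (Γ y ∸ K) y)                 ≡⟨ cong not (sym (f-high y y-high)) ⟩
      not (f y) ∎
      where
      open ≡-Reasoning
      y = flipAt top x
      y-high : low y ≡ false
      y-high = trans (low-flip-top x) (cong not e)
      Γ-same : Γ (flipAt (a x) y) ≡ Γ y
      Γ-same = Γ-flipAt-∉ (a x) (a∉M x e) y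

    f-ψ : ∀ x → low x ≡ true → f (ψ x) ≡ f x
    f-ψ x e = trans (cong f (ψ-low x e)) (trans (f-low _ (trans (cong low (sym (ψ-low x e))) (trans (low-ψ x) e)))
                (trans (parityOn-flipAt-∉ M (a x) (a∉M x e) x) (sym (f-low x e))))

    f-F-disagree-half : count n (λ x → low x ∧ (F x xor f x)) + count n (λ x → low x ∧ (F x xor f x)) ≡ count n low
    f-F-disagree-half = count-disagree-half n ψ ψ-involutive low F f low-ψ F-ψ f-ψ

  errors≥quarter-if-ignores-top : (g : Input n → Bool) → (∀ x → g (flipAt top x) ≡ g x) → 2 ^ n ≤ 4 * errors g
  errors≥quarter-if-ignores-top g g-inv = ≤-trans (quarter≤ X (count n low) f-F-disagree-half count-low-double) (*-monoʳ-≤ 4 X≤errors)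
    where
    open TopPairing using (F; low-flip-top; f-F-disagree-half)
    X : ℕ
    X = count n (λ x → low x ∧ (F x xor f x))
    split : errors g ≡ count n (λ x → (f x xor g x) ∧ low x) + count n (λ x → (F x xor g x) ∧ low x)
    split = trans (count-split n (λ x → f x xor g x) low) (cong (count n (λ x → (f x xor g x) ∧ low x) +_)
      (trans (sym (count-involution n (flipAt top) (flipAt-involutive top) _))
             (count-cong n (λ x → cong₂ (λ u v → (F x xor u) ∧ v) (g-inv x) (trans (cong not (low-flip-top x)) (not-involutive (low x)))))))
    X≤errors : X ≤ errors g
    X≤errors = subst (X ≤_) (sym split)
      (subst (X ≤_) (sumL-+ (allInputs n) (λ x → 𝟙 ((f x xor g x) ∧ low x)) (λ x → 𝟙 ((F x xor g x) ∧ low x)))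
             (sumL-mono (allInputs n) (λ x → disagree-triangle (f x) (F x) (g x) (low x))))

  open Cut using (hitCount; cutJunta; errors-cutJunta; hitCount≤errors; hitCount≤count-high; cutJunta-ignores-T)

  admissible? : (T : Subset n) → Dec (ChiAdmissible M T)
  admissible? T = all? (λ i → (lookup T i Bool.≟ true) →-dec (lookup M i Bool.≟ false)) ×-dec (n / 4 ≤? ∣ T ∣)

  4*errors-cutJunta≤2^n : ∀ T → 4 * errors (cutJunta T) ≤ 2 ^ n
  4*errors-cutJunta≤2^n T = begin
    4 * errors (cutJunta T)                         ≡⟨ sym (quadruple (errors (cutJunta T))) ⟩
    (errors (cutJunta T) + errors (cutJunta T)) + (errors (cutJunta T) + errors (cutJunta T))
                                                    ≡⟨ cong₂ _+_ (errors-cutJunta T) (errors-cutJunta T) ⟩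
    hitCount T + hitCount T                         ≤⟨ +-mono-≤ (hitCount≤count-high T) (hitCount≤count-high T) ⟩
    count n (λ x → not (low x)) + count n (λ x → not (low x)) ≡⟨ cong₂ _+_ count-high≡count-low count-high≡count-low ⟩
    count n low + count n low                       ≡⟨ count-low-double ⟩
    2 ^ n ∎
    where open ≤-Reasoning

  module Optimum (k≡n∸n/4 : 3 * n / 4 ≡ n ∸ n / 4) (T₀ : Subset n) (T₀-admissible : ChiAdmissible M T₀) where

    -- Inadmissible sets weigh more than any hit count, so the minimiser is admissible.
    weight : Subset n → ℕ
    weight T = if does (admissible? T) then hitCount T else suc (2 ^ n)

    weight-admissible : ∀ T → ChiAdmissible M T → weight T ≡ hitCount T
    weight-admissible T adm rewrite dec-true (admissible? T) adm = refl

    minimizer : Σ (Subset n) λ T → (weight T ≤ weight T₀) × (∀ T′ → T′ ∈ allInputs n → weight T ≤ weight T′)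
    minimizer = argmin (allInputs n) weight T₀

    Tmin : Subset n
    Tmin = proj₁ minimizer

    weight-inadmissible : ∀ T → ¬ ChiAdmissible M T → weight T ≡ suc (2 ^ n)
    weight-inadmissible T ¬adm rewrite dec-false (admissible? T) ¬adm = refl

    Tmin-admissible : ChiAdmissible M Tmin
    Tmin-admissible with admissible? Tmin
    ... | yes adm  = adm
    ... | no  ¬adm = ⊥-elim (<-irrefl refl (begin-strict
      2 ^ n              <⟨ n<1+n _ ⟩
      suc (2 ^ n)        ≡⟨ sym (weight-inadmissible Tmin ¬adm) ⟩
      weight Tmin        ≤⟨ proj₁ (proj₂ minimizer) ⟩
      weight T₀          ≡⟨ weight-admissible T₀ T₀-admissible ⟩
      hitCount T₀        ≤⟨ count≤2^n n (Cut.hits T₀) ⟩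
      2 ^ n              ∎))
      where open ≤-Reasoning

    Tmin-minimal : ∀ T → ChiAdmissible M T → hitCount Tmin ≤ hitCount T
    Tmin-minimal T adm = subst₂ _≤_ (weight-admissible Tmin Tmin-admissible) (weight-admissible T adm)
      (proj₂ (proj₂ minimizer) T (∈-allInputs n T))

    cutJunta-isJunta : IsJunta (3 * n / 4) (cutJunta Tmin)
    cutJunta-isJunta = ∁ Tmin
      , subst (∣ ∁ Tmin ∣ ≤_) (sym k≡n∸n/4)
              (subst (_≤ n ∸ n / 4) (sym (∣∁p∣≡n∸∣p∣ Tmin)) (∸-monoʳ-≤ n (proj₂ Tmin-admissible)))
      , cutJunta-ignores-T Tmin (proj₁ Tmin-admissible)

    errors-cutJunta-optimal : ∀ g → IsJunta (3 * n / 4) g → errors (cutJunta Tmin) ≤ errors g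
    errors-cutJunta-optimal g (J , ∣J∣≤ , g-on-J)
      with any? (λ i → (lookup M i Bool.≟ true) ×-dec (lookup J i Bool.≟ false))
    ... | yes (i , Mi , Ji) = *-cancelˡ-≤ 4 (≤-trans (4*errors-cutJunta≤2^n Tmin) quarter)
      where
      g-inv : ∀ x → g (flipAt i x) ≡ g x
      g-inv x = g-on-J (flipAt i x) x (λ j Jj → flipAt-other i j x (λ { refl → true≢false (trans (sym Jj) Ji) }))
      quarter : 2 ^ n ≤ 4 * errors g
      quarter with i ≟ top
      ... | yes refl  = errors≥quarter-if-ignores-top g g-inv
      ... | no  i≢top = errors≥quarter-if-ignores-∈M g i Mi i≢top g-inv
    ... | no  ∄i = +-double-cancel-≤ _ _ (subst (_≤ errors g + errors g) (sym (errors-cutJunta Tmin))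
                     (≤-trans (Tmin-minimal T T-admissible) (hitCount≤errors T g g-inv)))
      where
      T = ∁ J
      J-false⇒∉M : ∀ i → lookup J i ≡ false → lookup M i ≡ false
      J-false⇒∉M i Ji = bool-cases (lookup M i) (λ Mi → ⊥-elim (∄i (i , Mi , Ji))) id
      T-true⇒J-false : ∀ i → lookup T i ≡ true → lookup J i ≡ false
      T-true⇒J-false i Ti = ∁-true⇒false J i Ti
      T-admissible : ChiAdmissible M T
      T-admissible = (λ i Ti → J-false⇒∉M i (T-true⇒J-false i Ti))
        , subst (n / 4 ≤_) (sym (∣∁p∣≡n∸∣p∣ J))
                (subst (_≤ n ∸ ∣ J ∣) (m∸[m∸n]≡n (m/n≤m n 4)) (∸-monoʳ-≤ n (subst (∣ J ∣ ≤_) k≡n∸n/4 ∣J∣≤)))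
      g-inv : ∀ i x → lookup T i ≡ true → g (flipAt i x) ≡ g x
      g-inv i x Ti = g-on-J (flipAt i x) x
        (λ j Jj → flipAt-other i j x (λ { refl → true≢false (trans (sym Jj) (T-true⇒J-false i Ti)) }))

    isDistToJunta : IsDistToJunta (3 * n / 4) f (dist f (cutJunta Tmin))
    isDistToJunta = (cutJunta Tmin , cutJunta-isJunta , refl)
                  , λ g g-junta → frac-monoˡ-≤ (2 ^ n)
                      (subst₂ _≤_ (sym (countᵇ≡sumL _ (allInputs n))) (sym (countᵇ≡sumL _ (allInputs n)))
                                  (errors-cutJunta-optimal g g-junta))

  module _ (σ-injective : Injective _≡_ _≡_ σ) where

    blockEdge-sample : (k : Fin K) → blockEdge (toℕ k) ≡ edge G (proj₁ (lookup H k))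
    blockEdge-sample k with toℕ k <? half n
    ... | yes k<K = cong (λ i → edge G (proj₁ (lookup H i))) (fromℕ<-toℕ k k<K)
    ... | no  k≮K = ⊥-elim (k≮K (toℕ<n k))

    hitCount≡ : (T : Subset n) → hitCount T ≡ fibreSize n (n / 2) σ * blocksTouching G H T
    hitCount≡ T = begin
      hitCount T
        ≡⟨ sumInputs-by-fibres n (n / 2) σ σ-injective (λ γ → 𝟙 (hitsValue γ)) ⟩
      s * sumN (2 ^ (n / 2)) (λ γ → 𝟙 (hitsValue γ))
        ≡⟨ cong (s *_) (trans (cong (λ z → sumN z (λ γ → 𝟙 (hitsValue γ))) (trans 2^m≡2K (cong (K +_) (+-identityʳ K))))
                              (sumN-+ K K (λ γ → 𝟙 (hitsValue γ)))) ⟩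
      s * (sumN K (λ γ → 𝟙 (hitsValue γ)) + sumN K (λ i → 𝟙 (hitsValue (K + i))))
        ≡⟨ cong (λ z → s * (z + sumN K (λ i → 𝟙 (hitsValue (K + i))))) (sumN-vanishing K _ low-misses) ⟩
      s * sumN K (λ i → 𝟙 (hitsValue (K + i)))
        ≡⟨ cong (s *_) (trans (sumN-cong K high-hits) (sumN≡sumFin K _)) ⟩
      s * sumFin K (λ k → 𝟙 (touchesBlock (toℕ k)))
        ≡⟨ cong (s *_) (sumFin-cong K (λ k → cong (λ ed → 𝟙 (lookup T (proj₁ ed) ∨ lookup T (proj₂ ed))) (blockEdge-sample k))) ⟩
      s * blocksTouching G H T ∎
      where
      open ≡-Reasoning
      open Cut T using (hitsValue; touchesBlock)
      s = fibreSize n (n / 2) σ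
      low-misses : ∀ γ → γ < K → 𝟙 (hitsValue γ) ≡ 0
      low-misses γ γ<K rewrite <⇒<ᵇ≡true γ<K = refl
      high-hits : ∀ i → 𝟙 (hitsValue (K + i)) ≡ 𝟙 (touchesBlock i)
      high-hits i rewrite ≮⇒<ᵇ≡false (λ lt → <-irrefl refl (≤-<-trans (m≤m+n K i) lt)) | m+n∸m≡n K i = refl

    fibreSize>0 : 0 < fibreSize n (n / 2) σ
    fibreSize>0 with fibreSize n (n / 2) σ | fibreSize-*-2^m n (n / 2) σ σ-injective
    ... | zero  | e = ⊥-elim (<-irrefl e (m^n>0 2 n))
    ... | suc _ | _ = s≤s z≤n

    dist-cutJunta : (T : Subset n) → dist f (cutJunta T) ≡ frac (blocksTouching G H T) (4 * K)
    dist-cutJunta T = trans (cong (λ z → frac z (2 ^ n)) (countᵇ≡sumL _ (allInputs n)))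
      (frac-cong (errors (cutJunta T)) (2 ^ n) (blocksTouching G H T) (4 * K) (m^n>0 2 n) (0<* {4} (s≤s z≤n) 0<K) cross)
      where
      s = fibreSize n (n / 2) σ
      cross : errors (cutJunta T) * (4 * K) ≡ blocksTouching G H T * 2 ^ n
      cross = begin
        errors (cutJunta T) * (4 * K)                               ≡⟨ regroup (errors (cutJunta T)) K ⟩
        (errors (cutJunta T) + errors (cutJunta T)) * (2 * K)       ≡⟨ cong (_* (2 * K)) (trans (errors-cutJunta T) (hitCount≡ T)) ⟩
        s * blocksTouching G H T * (2 * K)                          ≡⟨ reorder s (blocksTouching G H T) (2 * K) ⟩
        blocksTouching G H T * (s * (2 * K))                        ≡⟨ cong (λ z → blocksTouching G H T * (s * z)) (sym 2^m≡2K) ⟩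
        blocksTouching G H T * (s * 2 ^ (n / 2))                    ≡⟨ cong (blocksTouching G H T *_) (fibreSize-*-2^m n (n / 2) σ σ-injective) ⟩
        blocksTouching G H T * 2 ^ n                                ∎
        where
        open ≡-Reasoning
        regroup : ∀ e K → e * (4 * K) ≡ (e + e) * (2 * K)
        regroup = solve-∀
        reorder : ∀ s c k → s * c * k ≡ c * (s * k)
        reorder = solve-∀

    blocksTouching-monotone : ∀ {T T′} → hitCount T ≤ hitCount T′ → blocksTouching G H T ≤ blocksTouching G H T′
    blocksTouching-monotone {T} {T′} h =
      *-cancelˡ-≤ (fibreSize n (n / 2) σ) {{ℕ.>-nonZero fibreSize>0}} (subst₂ _≤_ (hitCount≡ T) (hitCount≡ T′) h)

    distance-estimate : 3 * n / 4 ≡ n ∸ n / 4 → 0 < numEdges G → (c : ℚ) → IsChi M G c →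
      (ε : ℚ) (q : ℕ) → 0 < q → frac 1 q ℚ.≤ ε → (∀ e → q * ∣ numEdges G * multiplicity H e - K ∣ ≤ K) →
      ∃ λ d → IsDistToJunta (3 * n / 4) f d × (c ℚ.* frac 1 4 ℚ.- ε ℚ.≤ d) × (d ℚ.≤ c ℚ.* frac 1 4 ℚ.+ ε)
    distance-estimate k≡n∸n/4 0<E c ((T₀ , T₀-admissible , chi≡c) , c-min) ε q 0<q 1/q≤ε close =
      dist f (cutJunta Tmin) , isDistToJunta , lower , upper
      where
      open Optimum k≡n∸n/4 T₀ T₀-admissible
      instance
        quarter-nonNeg : ℚ.NonNegative (frac 1 4)
        quarter-nonNeg = ℚ.nonNegative (frac-≤ 0 1 1 4 (s≤s z≤n) (s≤s z≤n) z≤n)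
      upper : dist f (cutJunta Tmin) ℚ.≤ c ℚ.* frac 1 4 ℚ.+ ε
      upper = begin
        dist f (cutJunta Tmin)
          ≡⟨ dist-cutJunta Tmin ⟩
        frac (blocksTouching G H Tmin) (4 * K)
          ≤⟨ frac-monoˡ-≤ (4 * K) (blocksTouching-monotone {Tmin} {T₀} (Tmin-minimal T₀ T₀-admissible)) ⟩
        frac (blocksTouching G H T₀) (4 * K)
          ≤⟨ frac-≤-quarter+1/q _ _ _ K q 0<E 0<K 0<q (blocksTouching-upper G H q close T₀) ⟩
        frac (numTouching G T₀) (numEdges G) ℚ.* frac 1 4 ℚ.+ frac 1 q
          ≡⟨ cong (λ u → u ℚ.* frac 1 4 ℚ.+ frac 1 q) (trans (sym (chiFrac≡ M G G-on T₀ T₀-admissible)) chi≡c) ⟩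
        c ℚ.* frac 1 4 ℚ.+ frac 1 q
          ≤⟨ ℚP.+-monoʳ-≤ (c ℚ.* frac 1 4) 1/q≤ε ⟩
        c ℚ.* frac 1 4 ℚ.+ ε ∎
        where open ℚP.≤-Reasoning
      lower : c ℚ.* frac 1 4 ℚ.- ε ℚ.≤ dist f (cutJunta Tmin)
      lower = begin
        c ℚ.* frac 1 4 ℚ.- ε
          ≤⟨ ℚP.+-mono-≤ (ℚP.*-monoʳ-≤-nonNeg (frac 1 4) c≤chi) (ℚP.neg-antimono-≤ 1/q≤ε) ⟩
        frac (numTouching G Tmin) (numEdges G) ℚ.* frac 1 4 ℚ.- frac 1 q
          ≤⟨ quarter-1/q≤frac _ _ _ K q 0<E 0<K 0<q (blocksTouching-lower G H q close Tmin) ⟩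
        frac (blocksTouching G H Tmin) (4 * K)
          ≡⟨ sym (dist-cutJunta Tmin) ⟩
        dist f (cutJunta Tmin) ∎
        where
        open ℚP.≤-Reasoning
        c≤chi : c ℚ.≤ frac (numTouching G Tmin) (numEdges G)
        c≤chi = subst (c ℚ.≤_) (chiFrac≡ M G G-on Tmin Tmin-admissible) (c-min Tmin Tmin-admissible)

n<2^n : ∀ k → k < 2 ^ k
n<2^n zero    = s≤s z≤n
n<2^n (suc k) = begin-strict
  suc k          <⟨ s≤s (n<2^n k) ⟩
  suc (2 ^ k)    ≤⟨ +-monoˡ-≤ (2 ^ k) (m^n>0 2 k) ⟩
  2 ^ k + 2 ^ k  ≡⟨ cong (2 ^ k +_) (sym (+-identityʳ _)) ⟩
  2 ^ suc k      ∎
  where open ≤-Reasoning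

t⁴ : ℕ → ℕ
t⁴ t = t * t * t * t

t⁴-step : ∀ u → t⁴ (7 + u) ≤ 2 * t⁴ (6 + u)
t⁴-step u = subst (t⁴ (7 + u) ≤_) (sym (expand u)) (m≤m+n (t⁴ (7 + u)) _)
  where
  expand : ∀ u → 2 * ((6 + u) * (6 + u) * (6 + u) * (6 + u))
               ≡ (7 + u) * (7 + u) * (7 + u) * (7 + u) + (u * u * u * u + 20 * (u * u * u) + 138 * (u * u) + 356 * u + 191)
  expand = solve-∀

2^t*t⁴≤64*4^t : ∀ u → 2 ^ (6 + u) * t⁴ (6 + u) ≤ 64 * 4 ^ (6 + u)
2^t*t⁴≤64*4^t zero    = ≤ᵇ⇒≤ (2 ^ 6 * t⁴ 6) (64 * 4 ^ 6) _
2^t*t⁴≤64*4^t (suc u) = begin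
  2 ^ (7 + u) * t⁴ (7 + u)         ≤⟨ *-monoʳ-≤ (2 ^ (7 + u)) (t⁴-step u) ⟩
  2 ^ (7 + u) * (2 * t⁴ (6 + u))   ≡⟨ e₁ (2 ^ (6 + u)) (t⁴ (6 + u)) ⟩
  4 * (2 ^ (6 + u) * t⁴ (6 + u))   ≤⟨ *-monoʳ-≤ 4 (2^t*t⁴≤64*4^t u) ⟩
  4 * (64 * 4 ^ (6 + u))           ≡⟨ e₂ (4 ^ (6 + u)) ⟩
  64 * 4 ^ (7 + u)                 ∎
  where
  open ≤-Reasoning
  e₁ : ∀ a p → 2 * a * (2 * p) ≡ 4 * (a * p)
  e₁ = solve-∀
  e₂ : ∀ a → 4 * (64 * a) ≡ 64 * (4 * a)
  e₂ = solve-∀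

polynomial≤4^t : ∀ C → Σ ℕ λ t₀ → ∀ t → t₀ ≤ t → C * t⁴ t ≤ 4 ^ t
polynomial≤4^t C = 6 + 64 * C , bound
  where
  bound : ∀ t → 6 + 64 * C ≤ t → C * t⁴ t ≤ 4 ^ t
  bound t t₀≤t = *-cancelˡ-≤ 64 (begin
    64 * (C * t⁴ t)                    ≡⟨ sym (*-assoc 64 C (t⁴ t)) ⟩
    64 * C * t⁴ t                      ≤⟨ *-monoˡ-≤ (t⁴ t) (<⇒≤ (<-≤-trans (≤-<-trans (m≤n+m (64 * C) 6) (s≤s t₀≤t)) (n<2^n t))) ⟩
    2 ^ t * t⁴ t                       ≡⟨ cong (λ z → 2 ^ z * t⁴ z) (sym t≡) ⟩
    2 ^ (6 + (t ∸ 6)) * t⁴ (6 + (t ∸ 6)) ≤⟨ 2^t*t⁴≤64*4^t (t ∸ 6) ⟩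
    64 * 4 ^ (6 + (t ∸ 6))             ≡⟨ cong (λ z → 64 * 4 ^ z) t≡ ⟩
    64 * 4 ^ t                         ∎)
    where
    open ≤-Reasoning
    t≡ : 6 + (t ∸ 6) ≡ t
    t≡ = m+[n∸m]≡n (≤-trans (m≤m+n 6 (64 * C)) t₀≤t)

t*4/2≡t*2 : ∀ t → t * 4 / 2 ≡ t * 2
t*4/2≡t*2 t = trans (cong (_/ 2) (sym (*-assoc t 2 2))) (m*n/n≡m (t * 2) 2)

three-quarters : ∀ t → 3 * (t * 4) / 4 ≡ t * 4 ∸ t * 4 / 4
three-quarters t = begin
  3 * (t * 4) / 4       ≡⟨ cong (_/ 4) (sym (*-assoc 3 t 4)) ⟩
  3 * t * 4 / 4         ≡⟨ m*n/n≡m (3 * t) 4 ⟩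
  3 * t                 ≡⟨ sym (m+n∸n≡m (3 * t) t) ⟩
  3 * t + t ∸ t         ≡⟨ cong₂ _∸_ (split t) (sym (m*n/n≡m t 4)) ⟩
  t * 4 ∸ t * 4 / 4     ∎
  where
  open ≡-Reasoning
  split : ∀ t → 3 * t + t ≡ t * 4
  split = solve-∀

top-bit : ∀ m → 0 < m →
  Σ (Fin m) λ k₀ → (2 ^ m ≡ 2 * (2 ^ m / 2)) × (∀ b → (val m b <ᵇ 2 ^ m / 2) ≡ not (b k₀))
top-bit (suc m′) _ = fromℕ m′ , cong (2 *_) (sym half≡) , λ b → trans (cong (val (suc m′) b <ᵇ_) half≡) (val-top m′ b)
  where
  half≡ : 2 ^ suc m′ / 2 ≡ 2 ^ m′
  half≡ = trans (cong (_/ 2) (*-comm 2 (2 ^ m′))) (m*n/n≡m (2 ^ m′) 2)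

0<t*4/2 : ∀ {t} → 0 < t → 0 < t * 4 / 2
0<t*4/2 {t} 0<t = subst (0 <_) (sym (t*4/2≡t*2 t)) (0<* 0<t (s≤s z≤n))

q³E²≤K : ∀ q t₀ → (∀ t → t₀ ≤ t → 512 * (q * q * q) * t⁴ t ≤ 4 ^ t) → ∀ t → suc t₀ ≤ t →
  ∀ E → E ≤ t * 4 * (t * 4) → q * q * q * (E * E) ≤ 2 ^ (t * 4 / 2) / 2
q³E²≤K q t₀ growth t t₀<t E E≤n² = *-cancelˡ-≤ 2 (begin
  2 * (q * q * q * (E * E))                                   ≤⟨ *-monoʳ-≤ 2 (*-monoʳ-≤ (q * q * q) (*-mono-≤ E≤n² E≤n²)) ⟩
  2 * (q * q * q * (t * 4 * (t * 4) * (t * 4 * (t * 4))))     ≡⟨ e₁ q t ⟩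
  512 * (q * q * q) * t⁴ t                                    ≤⟨ growth t (≤-trans (n≤1+n t₀) t₀<t) ⟩
  4 ^ t                                                       ≡⟨ trans (^-*-assoc 2 2 t) (cong (2 ^_) (trans (*-comm 2 t) (sym (t*4/2≡t*2 t)))) ⟩
  2 ^ (t * 4 / 2)                                             ≡⟨ proj₁ (proj₂ (top-bit (t * 4 / 2) (0<t*4/2 (≤-trans (s≤s z≤n) t₀<t)))) ⟩
  2 * (2 ^ (t * 4 / 2) / 2)                                   ∎)
  where
  open ≤-Reasoning
  e₁ : ∀ q t → 2 * (q * q * q * (t * 4 * (t * 4) * (t * 4 * (t * 4)))) ≡ 512 * (q * q * q) * (t * t * t * t)
  e₁ = solve-∀


module _ (q : ℕ) (0<q : 0 < q) (ε : ℚ) (1/q≤ε : frac 1 q ℚ.≤ ε) (t₀ : ℕ)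
  (growth : ∀ t → t₀ ≤ t → 512 * (q * q * q) * t⁴ t ≤ 4 ^ t) where

  concentrated-samples-suffice : ∀ t → suc t₀ ≤ t → let n = t * 4 in
    (M : Subset n) (σ : Fin (n / 2) → Fin n) → Injective _≡_ _≡_ σ → (∀ k → σ k ∈ₛ M) → (A : Subset n) →
    (G : Graph n) → IsGraphOn (∁ M) G → 0 < numEdges G → (c : ℚ) → IsChi M G c →
    Σ (List (Sample n G)) λ S → Unique S ×
      All (λ H → ∃ λ d → IsDistToJunta (3 * n / 4) (fMAH M σ A G H) d ×
                         (c ℚ.* frac 1 4 ℚ.- ε ℚ.≤ d) × (d ℚ.≤ c ℚ.* frac 1 4 ℚ.+ ε)) S ×
      ((1ℚ ℚ.- ε) ℚ.* ℕ→ℚ ((2 * numEdges G) ^ half n) ℚ.≤ ℕ→ℚ (length S))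
  concentrated-samples-suffice t t₀<t M σ σ-injective σ∈M A G G-on 0<E c c≡χ =
    concentratedSamples K q , unique , estimates , enough
    where
    n = t * 4
    K = half n
    open Moments (numEdges G)
    top : Σ (Fin (n / 2)) λ k₀ → (2 ^ (n / 2) ≡ 2 * K) × (∀ b → (val (n / 2) b <ᵇ K) ≡ not (b k₀))
    top = top-bit (n / 2) (0<t*4/2 (≤-trans (s≤s z≤n) t₀<t))
    big : q * q * q * (numEdges G * numEdges G) ≤ K
    big = q³E²≤K q t₀ growth t t₀<t (numEdges G) (numEdges≤n² G)
    unique : Unique (concentratedSamples K q)
    unique = UniqueP.filter⁺ (Concentrated? K q)
      (allVecs-unique draws (UniqueP.cartesianProduct⁺ (UniqueP.allFin⁺ _) (((λ ()) ∷ []) ∷ [] ∷ [])) K)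
    estimates : All (λ H → ∃ λ d → IsDistToJunta (3 * n / 4) (fMAH M σ A G H) d ×
                               (c ℚ.* frac 1 4 ℚ.- ε ℚ.≤ d) × (d ℚ.≤ c ℚ.* frac 1 4 ℚ.+ ε)) (concentratedSamples K q)
    estimates = All.map (λ {H} close → FixedSample.distance-estimate M σ A G H (λ k → []=⇒lookup (σ∈M k)) G-on
                                         (proj₁ top) (proj₁ (proj₂ top)) (λ x → proj₂ (proj₂ top) (λ k → lookup x (σ k)))
                                         σ-injective (three-quarters t) 0<E c c≡χ ε q 0<q 1/q≤ε close)
                        (AllP.all-filter (Concentrated? K q) (samples K))
    enough : (1ℚ ℚ.- ε) ℚ.* ℕ→ℚ ((2 * numEdges G) ^ K) ℚ.≤ ℕ→ℚ (length (concentratedSamples K q))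
    enough = subst (λ N → (1ℚ ℚ.- ε) ℚ.* ℕ→ℚ N ℚ.≤ ℕ→ℚ (length (concentratedSamples K q))) (#samples≡ K)
      (1-ε≤fraction ε q (#samples K) _ (#rejected K q) 0<q 1/q≤ε (length-concentrated+rejected K q)
        (rejected-bound K q (≤-trans (0<* (0<* (0<* 0<q 0<q) 0<q) (0<* 0<E 0<E)) big) 0<E 0<q big))

lemma4p1 : ∀ (ε : ℚ) → 0ℚ ℚ.< ε → Σ ℕ λ n₀ →
    ∀ (n : ℕ) → n₀ ℕ.≤ n → 4 ∣ n →
    (M : Subset n) → ∣ M ∣ ≡ n / 2 →
    (σ : Fin (n / 2) → Fin n) → Injective _≡_ _≡_ σ → (∀ k → σ k ∈ₛ M) →
    (A : Subset n) → A ⊆ ∁ M → ∣ A ∣ ≡ n / 4 →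
    (G : Graph n) → IsGraphOn (∁ M) G → 0 ℕ.< numEdges G →
    (c : ℚ) → IsChi M G c →
    Σ (List (Sample n G)) λ S → Unique S ×
    All (λ H → ∃ λ d → IsDistToJunta (3 * n / 4) (fMAH M σ A G H) d ×
    (c ℚ.* frac 1 4 ℚ.- ε ℚ.≤ d) × (d ℚ.≤ c ℚ.* frac 1 4 ℚ.+ ε)) S ×
    ((1ℚ ℚ.- ε) ℚ.* ℕ→ℚ ((2 * numEdges G) ^ half n) ℚ.≤ ℕ→ℚ (length S))
lemma4p1 ε 0<ε = suc t₀ * 4 , λ { .(t * 4) n₀≤n (divides t refl) M _ σ σ-injective σ∈M A _ _ →
  concentrated-samples-suffice q 0<q ε 1/q≤ε′ t₀ growth t (*-cancelʳ-≤ (suc t₀) t 4 n₀≤n) M σ σ-injective σ∈M A }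
  where
  q : ℕ
  q = proj₁ (1/q≤ε ε 0<ε)
  0<q : 0 < q
  0<q = proj₁ (proj₂ (1/q≤ε ε 0<ε))
  1/q≤ε′ : frac 1 q ℚ.≤ ε
  1/q≤ε′ = proj₂ (proj₂ (1/q≤ε ε 0<ε))
  t₀ : ℕ
  t₀ = proj₁ (polynomial≤4^t (512 * (q * q * q)))
  growth : ∀ t → t₀ ≤ t → 512 * (q * q * q) * t⁴ t ≤ 4 ^ t
  growth = proj₂ (polynomial≤4^t (512 * (q * q * q)))
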